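{- Let $G$ be an undirected unweighted graph on $n$ vertices with terminals $s,t$, accessed via cut queries, and let $f$ and $\Delta\le f$ be parameters with the promise that $\nu(G)\ge f$. Then there is a deterministic algorithm which makes $\widetilde{O}\!\left(\frac{n^2}{\sqrt{\Delta}}\right)$ cut queries to $G$ and outputs $H\preceq G$ with $\nu(H)\ge f-\Delta$.
   Context: A cut query specifies a partition of the vertex set and returns the number of edges of $G$ crossing it. $H\preceq G$ means $H$ is a subgraph of $G$ on the same vertex set. $\nu(\cdot)$ is the minimum $s$-$t$ cut value, equivalently the maximum number of edge-disjoint $s$-$t$ paths. $\widetilde{O}$ hides polylogarithmic factors in $n$. -}

module Defs where

open import Data.Nat using (ℕ; zero; suc; _+_; _*_; _^_; _≤_; _<ᵇ_)
open import Data.Nat.Logarithm using (⌊log₂_⌋)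
open import Data.Fin using (Fin; zero; suc; toℕ)
open import Data.Bool using (Bool; true; false; _∧_; _xor_; if_then_else_)
open import Relation.Binary.PropositionalEquality using (_≡_)

sumFin : (n : ℕ) → (Fin n → ℕ) → ℕ
sumFin zero    f = 0
sumFin (suc n) f = f zero + sumFin n (λ i → f (suc i))

-- Only the entries G i j with toℕ i < toℕ j are ever read: the edge {i,j}
-- (i < j) is present iff G i j ≡ true.  (Lower triangle / diagonal ignored.)
Graph : ℕ → Set
Graph n = Fin n → Fin n → Bool

_⪯_ : {n : ℕ} → Graph n → Graph n → Set
_⪯_ {n} H G = (i j : Fin n) → (toℕ i <ᵇ toℕ j) ≡ true → H i j ≡ true → G i j ≡ true

VSet : ℕ → Set
VSet n = Fin n → Bool

cutValue : {n : ℕ} → Graph n → VSet n → ℕ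
cutValue {n} G S =
  sumFin n (λ i → sumFin n (λ j →
    if (toℕ i <ᵇ toℕ j) ∧ G i j ∧ (S i xor S j) then 1 else 0))

νAtLeast : {n : ℕ} → Graph n → Fin n → Fin n → ℕ → Set
νAtLeast {n} G s t k = (S : VSet n) → S s ≡ true → S t ≡ false → k ≤ cutValue G S

-- Deterministic adaptive cut-query algorithms (decision trees) with output type O.
data CutQueryAlg (n : ℕ) (O : Set) : Set where
  ret : O → CutQueryAlg n O
  ask : VSet n → (ℕ → CutQueryAlg n O) → CutQueryAlg n O

run : {n : ℕ} {O : Set} → CutQueryAlg n O → Graph n → O
run (ret o)   G = o
run (ask S k) G = run (k (cutValue G S)) G

queries : {n : ℕ} {O : Set} → CutQueryAlg n O → Graph n → ℕ
queries (ret o)   G = 0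
queries (ask S k) G = suc (queries (k (cutValue G S)) G)

-- Polylog base: 1 + ⌊log₂ n⌋ (≥ 1, avoids log 0).
logn : ℕ → ℕ
logn n = suc ⌊log₂ n ⌋

{-# OPTIONS --safe #-}
-- The algorithm is a shortest-augmenting-path search with distance labels ℓ (advance along admissible
-- arcs, otherwise raise the label of the head and retreat) that builds a unit flow inside G.  Admissible
-- arcs that cancel flow are known; an admissible edge is found by binary search over vertex indices,
-- each test "x has a neighbour in Y" costing three cut queries.
--
-- Labels stop at the least B with 2n² < B²(Δ + 1).  While the flow value φ has φ + Δ < f, every cut
-- {v | ℓ v > i} with i < ℓ s still has residual capacity above Δ, and that capacity is at most
-- 2·|ℓ⁻¹(i + 1)|·|ℓ⁻¹(i)|; summing over the ℓ s cuts with AM-GM gives ℓ(s)²(Δ + 1) ≤ 2n².  So once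
-- ℓ s reaches B the flow carries at least f − Δ units and its support is the required subgraph.
-- A potential argument bounds the number of steps by O(n B) = O(n²/√Δ), each costing O(log n) queries.
module Submission where

open import Defs
open import Data.Bool using (Bool; true; false; _∧_; _∨_; not; _xor_; if_then_else_) renaming (_≟_ to _≟ᴮ_)
open import Data.Bool.Properties using (∨-comm; ∧-comm; ∧-assoc; ∧-zeroʳ; ∧-identityʳ; ∨-zeroʳ; ∨-identityʳ; ¬-not)
open import Data.Fin using (Fin; zero; suc; toℕ; punchIn) renaming (_≟_ to _≟ᶠ_)
open import Data.Fin.Properties using (toℕ<n; toℕ-injective; punchInᵢ≢i; any?)
open import Data.Nat
open import Data.Nat.Properties
open import Data.Nat.Logarithm using (⌊log₂_⌋; ⌊log₂⌋-mono-≤; ⌊log₂[2^n]⌋≡n)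
open import Data.Nat.Tactic.RingSolver using (solve-∀)
open import Algebra.Properties.CommutativeSemigroup +-commutativeSemigroup using (xy∙z≈xz∙y)
open import Algebra.Properties.Semiring.Sum +-*-semiring
  using (sum; sum-syntax; sum-remove; sum-cong-≗; ∑-distrib-+; ∑-comm; *-distribˡ-sum; *-distribʳ-sum)
open import Data.List using (List; []; _∷_; length)
open import Data.Maybe using (Maybe; just; nothing)
open import Data.Product using (Σ; ∃; _×_; _,_; proj₁; proj₂)
open import Data.Sum using (_⊎_; inj₁; inj₂)
open import Function using (_∘_)
open import Relation.Binary.Definitions using (tri<; tri≈; tri>)
open import Relation.Binary.PropositionalEquality
open import Relation.Nullary using (¬_; Dec; yes; no; does; contradiction; _×-dec_)
open import Relation.Nullary.Decidable using (dec-true; dec-false)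

private variable
  n : ℕ

-- Indicators and finite sums

𝟙 : Bool → ℕ
𝟙 b = if b then 1 else 0

𝟙≤1 : ∀ b → 𝟙 b ≤ 1
𝟙≤1 true  = ≤-refl
𝟙≤1 false = z≤n

𝟙-∧ : ∀ a b → 𝟙 (a ∧ b) ≡ 𝟙 a * 𝟙 b
𝟙-∧ true  b = sym (+-identityʳ (𝟙 b))
𝟙-∧ false b = refl

𝟙-pos : ∀ {b} → 0 < 𝟙 b → b ≡ true
𝟙-pos {true} _ = refl

∧-true-l : ∀ {a b} → (a ∧ b) ≡ true → a ≡ true
∧-true-l {true} _ = refl

∧-true-r : ∀ {a b} → (a ∧ b) ≡ true → b ≡ true
∧-true-r {true} b≡true = b≡true

does-true : ∀ {P : Set} (P? : Dec P) → does P? ≡ true → P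
does-true (yes p) _ = p

does-false : ∀ {P : Set} (P? : Dec P) → does P? ≡ false → ¬ P
does-false (no ¬p) _ = ¬p

<ᵇ-true : ∀ {m k} → m < k → (m <ᵇ k) ≡ true
<ᵇ-true {m} {k} = dec-true (m <? k)

<ᵇ-false : ∀ {m k} → ¬ m < k → (m <ᵇ k) ≡ false
<ᵇ-false {m} {k} = dec-false (m <? k)

<ᵇ-sound : ∀ {m k} → (m <ᵇ k) ≡ true → m < k
<ᵇ-sound {m} {k} = does-true (m <? k)

≤ᵇ-true : ∀ {m k} → m ≤ k → (m ≤ᵇ k) ≡ true
≤ᵇ-true {m} {k} = dec-true (m ≤? k)

≤ᵇ-false : ∀ {m k} → ¬ m ≤ k → (m ≤ᵇ k) ≡ false
≤ᵇ-false {m} {k} = dec-false (m ≤? k)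

≤ᵇ-sound : ∀ {m k} → (m ≤ᵇ k) ≡ true → m ≤ k
≤ᵇ-sound {m} {k} = does-true (m ≤? k)

≡ᵇ-true : ∀ {m k} → m ≡ k → (m ≡ᵇ k) ≡ true
≡ᵇ-true {m} {k} = dec-true (m ≟ k)

≡ᵇ-false : ∀ {m k} → ¬ m ≡ k → (m ≡ᵇ k) ≡ false
≡ᵇ-false {m} {k} = dec-false (m ≟ k)

≡ᵇ-sound : ∀ {m k} → (m ≡ᵇ k) ≡ true → m ≡ k
≡ᵇ-sound {m} {k} = does-true (m ≟ k)

_==_ : Fin n → Fin n → Bool
a == b = does (a ≟ᶠ b)

==-refl : (a : Fin n) → (a == a) ≡ true
==-refl a = dec-true (a ≟ᶠ a) refl

==-≢ : {a b : Fin n} → ¬ a ≡ b → (a == b) ≡ false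
==-≢ {a = a} {b} = dec-false (a ≟ᶠ b)

==-sound : {a b : Fin n} → (a == b) ≡ true → a ≡ b
==-sound {a = a} {b} = does-true (a ≟ᶠ b)

∑-const : ∀ n c → ∑[ i < n ] c ≡ n * c
∑-const zero    c = refl
∑-const (suc n) c = cong (c +_) (∑-const n c)

∑-mono-≤ : {f g : Fin n → ℕ} → (∀ i → f i ≤ g i) → sum f ≤ sum g
∑-mono-≤ {zero}  f≤g = z≤n
∑-mono-≤ {suc n} f≤g = +-mono-≤ (f≤g zero) (∑-mono-≤ (f≤g ∘ suc))

∑-𝟙≤ : (p : Fin n → Bool) → ∑[ i < n ] 𝟙 (p i) ≤ n
∑-𝟙≤ {n} p = ≤-trans (∑-mono-≤ (𝟙≤1 ∘ p)) (≤-reflexive (trans (∑-const n 1) (*-identityʳ n)))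

∑-𝟙-pos : (p : Fin n → Bool) → 0 < ∑[ i < n ] 𝟙 (p i) → ∃ λ i → p i ≡ true
∑-𝟙-pos {suc n} p pos with p zero in p0
... | true  = zero , p0
... | false = let i , pi = ∑-𝟙-pos (p ∘ suc) pos in suc i , pi

∑-𝟙-zero : (p : Fin n → Bool) → ∑[ i < n ] 𝟙 (p i) ≡ 0 → ∀ i → p i ≡ false
∑-𝟙-zero {suc n} p ∑≡0 i with p zero in p0 | i
... | false | zero  = p0
... | false | suc i = ∑-𝟙-zero (p ∘ suc) ∑≡0 i

∑-pick : (x : Fin n) (g : Fin n → ℕ) → ∑[ i < n ] (𝟙 (i == x) * g i) ≡ g x
∑-pick {suc n} zero g = begin
  1 * g zero + ∑[ i < n ] (0 * g (suc i)) ≡⟨ cong₂ _+_ (*-identityˡ (g zero)) (∑-const n 0) ⟩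
  g zero + n * 0                          ≡⟨ cong (g zero +_) (*-zeroʳ n) ⟩
  g zero + 0                              ≡⟨ +-identityʳ (g zero) ⟩
  g zero                                  ∎
  where open ≡-Reasoning
∑-pick {suc n} (suc x) g = ∑-pick x (g ∘ suc)

∑-update : (x : Fin n) (g g′ : Fin n → ℕ) → (∀ i → ¬ i ≡ x → g′ i ≡ g i) →
           sum g′ + g x ≡ sum g + g′ x
∑-update {suc n} x g g′ agree = begin
  sum g′ + g x                        ≡⟨ cong (_+ g x) (sum-remove {i = x} g′) ⟩
  g′ x + sum (g′ ∘ punchIn x) + g x   ≡⟨ cong (λ r → g′ x + r + g x) rest ⟩
  g′ x + sum (g ∘ punchIn x) + g x    ≡⟨ swap-ends (g′ x) (sum (g ∘ punchIn x)) (g x) ⟩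
  g x + sum (g ∘ punchIn x) + g′ x    ≡⟨ cong (_+ g′ x) (sum-remove {i = x} g) ⟨
  sum g + g′ x                        ∎
  where
  open ≡-Reasoning
  rest : sum (g′ ∘ punchIn x) ≡ sum (g ∘ punchIn x)
  rest = sum-cong-≗ (λ j → agree (punchIn x j) (punchInᵢ≢i x j))
  swap-ends : ∀ a r b → a + r + b ≡ b + r + a
  swap-ends = solve-∀

∑∑ : (Fin n → Fin n → ℕ) → ℕ
∑∑ {n} f = ∑[ u < n ] ∑[ v < n ] f u v

∑∑-cong : {f g : Fin n → Fin n → ℕ} → (∀ u v → f u v ≡ g u v) → ∑∑ f ≡ ∑∑ g
∑∑-cong f≡g = sum-cong-≗ (λ u → sum-cong-≗ (f≡g u))

∑∑-mono-≤ : {f g : Fin n → Fin n → ℕ} → (∀ u v → f u v ≤ g u v) → ∑∑ f ≤ ∑∑ g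
∑∑-mono-≤ f≤g = ∑-mono-≤ (λ u → ∑-mono-≤ (f≤g u))

∑∑-distrib-+ : (f g : Fin n → Fin n → ℕ) → ∑∑ (λ u v → f u v + g u v) ≡ ∑∑ f + ∑∑ g
∑∑-distrib-+ f g =
  trans (sum-cong-≗ (λ u → ∑-distrib-+ (f u) (g u))) (∑-distrib-+ (λ u → sum (f u)) (λ u → sum (g u)))

∑∑-transpose : (f : Fin n → Fin n → ℕ) → ∑∑ f ≡ ∑∑ (λ u v → f v u)
∑∑-transpose f = ∑-comm f

sumFin≡sum : ∀ n (f : Fin n → ℕ) → sumFin n f ≡ sum f
sumFin≡sum zero    f = refl
sumFin≡sum (suc n) f = cong (f zero +_) (sumFin≡sum n (f ∘ suc))

-- Cut values as directed crossings

adj : Graph n → Fin n → Fin n → Bool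
adj G u v = ((toℕ u <ᵇ toℕ v) ∧ G u v) ∨ ((toℕ v <ᵇ toℕ u) ∧ G v u)

adj-sym : (G : Graph n) (u v : Fin n) → adj G u v ≡ adj G v u
adj-sym G u v = ∨-comm ((toℕ u <ᵇ toℕ v) ∧ G u v) ((toℕ v <ᵇ toℕ u) ∧ G v u)

leaves : VSet n → Fin n → Fin n → Bool
leaves S u v = S u ∧ not (S v)

crossing : (Fin n → Fin n → Bool) → VSet n → ℕ
crossing A S = ∑∑ (λ u v → 𝟙 (A u v ∧ leaves S u v))

private
  𝟙-xor : ∀ a b c → 𝟙 (c ∧ (a xor b)) ≡ 𝟙 (c ∧ a ∧ not b) + 𝟙 (c ∧ b ∧ not a)
  𝟙-xor true  true  true  = refl
  𝟙-xor true  false true  = refl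
  𝟙-xor false true  true  = refl
  𝟙-xor false false true  = refl
  𝟙-xor a     b     false = refl

  𝟙-∨-disjoint : ∀ c d e → (c ∧ d) ≡ false → 𝟙 ((c ∨ d) ∧ e) ≡ 𝟙 (c ∧ e) + 𝟙 (d ∧ e)
  𝟙-∨-disjoint true  false e _ = sym (+-identityʳ (𝟙 e))
  𝟙-∨-disjoint false d     e _ = refl

  below-disjoint : ∀ (u v : Fin n) x y → ((toℕ u <ᵇ toℕ v) ∧ x) ∧ ((toℕ v <ᵇ toℕ u) ∧ y) ≡ false
  below-disjoint u v x y with toℕ u <ᵇ toℕ v in u<v
  ... | false = refl
  ... | true = trans (cong (λ b → x ∧ b ∧ y) (<ᵇ-false {toℕ v} {toℕ u} (<⇒≯ (<ᵇ-sound u<v)))) (∧-zeroʳ x)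

cutValue≡crossing : (G : Graph n) (S : VSet n) → cutValue G S ≡ crossing (adj G) S
cutValue≡crossing {n} G S = begin
  cutValue G S
    ≡⟨ trans (sumFin≡sum n _) (sum-cong-≗ (λ u → sumFin≡sum n (λ v → 𝟙 (cut-term u v)))) ⟩
  ∑∑ (λ u v → 𝟙 (cut-term u v))
    ≡⟨ ∑∑-cong (λ u v → cong 𝟙 (∧-assoc (toℕ u <ᵇ toℕ v) (G u v) (S u xor S v))) ⟨
  ∑∑ (λ u v → 𝟙 (below u v ∧ (S u xor S v)))
    ≡⟨ ∑∑-cong (λ u v → 𝟙-xor (S u) (S v) (below u v)) ⟩
  ∑∑ (λ u v → forward u v + backward u v)
    ≡⟨ ∑∑-distrib-+ forward backward ⟩
  ∑∑ forward + ∑∑ backward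
    ≡⟨ cong (∑∑ forward +_) (∑∑-transpose backward) ⟩
  ∑∑ forward + ∑∑ (λ u v → backward v u)
    ≡⟨ ∑∑-distrib-+ forward (λ u v → backward v u) ⟨
  ∑∑ (λ u v → forward u v + backward v u)
    ≡⟨ ∑∑-cong (λ u v → 𝟙-∨-disjoint (below u v) (below v u) (leaves S u v) (below-disjoint u v (G u v) (G v u))) ⟨
  crossing (adj G) S
    ∎
  where
  open ≡-Reasoning
  below cut-term : Fin n → Fin n → Bool
  below u v = (toℕ u <ᵇ toℕ v) ∧ G u v
  cut-term u v = (toℕ u <ᵇ toℕ v) ∧ G u v ∧ (S u xor S v)
  forward backward : Fin n → Fin n → ℕ
  forward u v = 𝟙 (below u v ∧ leaves S u v)
  backward u v = 𝟙 (below u v ∧ leaves S v u)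

-- Finding a neighbour with cut queries

edgesTo : (Fin n → Fin n → Bool) → Fin n → VSet n → ℕ
edgesTo {n} A x Y = ∑[ v < n ] 𝟙 (A x v ∧ Y v)

insert : VSet n → Fin n → VSet n
insert Y x v = Y v ∨ (v == x)

⁅_⁆ : Fin n → VSet n
⁅ x ⁆ v = v == x

private
  insert-pointwise : ∀ a yu yv xu xv → (xu ≡ true → yu ≡ false) → (xv ≡ true → yv ≡ false) →
    𝟙 (a ∧ (yu ∨ xu) ∧ not (yv ∨ xv)) + 𝟙 (a ∧ xu ∧ yv) + 𝟙 (a ∧ yu ∧ xv)
      ≡ 𝟙 (a ∧ yu ∧ not yv) + 𝟙 (a ∧ xu ∧ not xv)
  insert-pointwise false _     _     _     _     _   _   = refl
  insert-pointwise true  true  _     true  _     x∉Y _   = contradiction (x∉Y refl) λ ()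
  insert-pointwise true  _     true  _     true  _   x∉Y = contradiction (x∉Y refl) λ ()
  insert-pointwise true  true  true  false false _   _   = refl
  insert-pointwise true  true  false false true  _   _   = refl
  insert-pointwise true  true  false false false _   _   = refl
  insert-pointwise true  false true  true  false _   _   = refl
  insert-pointwise true  false false true  true  _   _   = refl
  insert-pointwise true  false false true  false _   _   = refl
  insert-pointwise true  false _     false _     _   _   = refl

  𝟙-select : ∀ a e y → 𝟙 (a ∧ e ∧ y) ≡ 𝟙 e * 𝟙 (a ∧ y)
  𝟙-select a true  y = sym (+-identityʳ _)
  𝟙-select a false y = cong 𝟙 (∧-zeroʳ a)

  𝟙-select′ : ∀ a y e → 𝟙 (a ∧ y ∧ e) ≡ 𝟙 e * 𝟙 (a ∧ y)
  𝟙-select′ a y e = trans (cong (λ b → 𝟙 (a ∧ b)) (∧-comm y e)) (𝟙-select a e y)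

crossing-insert : (A : Fin n → Fin n → Bool) → (∀ u v → A u v ≡ A v u) →
                  (x : Fin n) (Y : VSet n) → Y x ≡ false →
                  crossing A (insert Y x) + edgesTo A x Y + edgesTo A x Y ≡ crossing A Y + crossing A ⁅ x ⁆
crossing-insert {n} A A-sym x Y x∉Y = begin
  crossing A (insert Y x) + edgesTo A x Y + edgesTo A x Y
    ≡⟨ cong₂ (λ p q → crossing A (insert Y x) + p + q) out-of-x≡edgesTo into-x≡edgesTo ⟨
  ∑∑ across + ∑∑ out-of-x + ∑∑ into-x
    ≡⟨ trans (∑∑-distrib-+ (λ u v → across u v + out-of-x u v) into-x)
             (cong (_+ ∑∑ into-x) (∑∑-distrib-+ across out-of-x)) ⟨
  ∑∑ (λ u v → across u v + out-of-x u v + into-x u v)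
    ≡⟨ ∑∑-cong (λ u v → insert-pointwise (A u v) (Y u) (Y v) (u == x) (v == x) (x∉Y′ u) (x∉Y′ v)) ⟩
  ∑∑ (λ u v → 𝟙 (A u v ∧ leaves Y u v) + 𝟙 (A u v ∧ leaves ⁅ x ⁆ u v))
    ≡⟨ ∑∑-distrib-+ (λ u v → 𝟙 (A u v ∧ leaves Y u v)) (λ u v → 𝟙 (A u v ∧ leaves ⁅ x ⁆ u v)) ⟩
  crossing A Y + crossing A ⁅ x ⁆
    ∎
  where
  open ≡-Reasoning
  x∉Y′ : ∀ u → (u == x) ≡ true → Y u ≡ false
  x∉Y′ u u≡x = trans (cong Y (==-sound u≡x)) x∉Y
  across out-of-x into-x : Fin n → Fin n → ℕ
  across u v = 𝟙 (A u v ∧ leaves (insert Y x) u v)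
  out-of-x u v = 𝟙 (A u v ∧ (u == x) ∧ Y v)
  into-x u v = 𝟙 (A u v ∧ Y u ∧ (v == x))
  out-of-x≡edgesTo : ∑∑ out-of-x ≡ edgesTo A x Y
  out-of-x≡edgesTo = begin
    ∑∑ out-of-x
      ≡⟨ ∑∑-cong (λ u v → 𝟙-select (A u v) (u == x) (Y v)) ⟩
    ∑[ u < n ] ∑[ v < n ] (𝟙 (u == x) * 𝟙 (A u v ∧ Y v))
      ≡⟨ sum-cong-≗ (λ u → *-distribˡ-sum (𝟙 (u == x)) (λ v → 𝟙 (A u v ∧ Y v))) ⟨
    ∑[ u < n ] (𝟙 (u == x) * ∑[ v < n ] 𝟙 (A u v ∧ Y v))
      ≡⟨ ∑-pick x (λ u → ∑[ v < n ] 𝟙 (A u v ∧ Y v)) ⟩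
    edgesTo A x Y
      ∎
  into-x≡edgesTo : ∑∑ into-x ≡ edgesTo A x Y
  into-x≡edgesTo = sum-cong-≗ λ u → begin
    ∑[ v < n ] into-x u v
      ≡⟨ sum-cong-≗ (λ v → 𝟙-select′ (A u v) (Y u) (v == x)) ⟩
    ∑[ v < n ] (𝟙 (v == x) * 𝟙 (A u v ∧ Y u))
      ≡⟨ ∑-pick x (λ v → 𝟙 (A u v ∧ Y u)) ⟩
    𝟙 (A u x ∧ Y u)
      ≡⟨ cong (λ b → 𝟙 (b ∧ Y u)) (A-sym u x) ⟩
    𝟙 (A x u ∧ Y u)
      ∎

_>>=_ : {A B : Set} → CutQueryAlg n A → (A → CutQueryAlg n B) → CutQueryAlg n B
ret a   >>= k = k a
ask S c >>= k = ask S (λ m → c m >>= k)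

run->>= : {A B : Set} (m : CutQueryAlg n A) (k : A → CutQueryAlg n B) (G : Graph n) →
          run (m >>= k) G ≡ run (k (run m G)) G
run->>= (ret a)   k G = refl
run->>= (ask S c) k G = run->>= (c (cutValue G S)) k G

queries->>= : {A B : Set} (m : CutQueryAlg n A) (k : A → CutQueryAlg n B) (G : Graph n) →
              queries (m >>= k) G ≡ queries m G + queries (k (run m G)) G
queries->>= (ret a)   k G = refl
queries->>= (ask S c) k G = cong suc (queries->>= (c (cutValue G S)) k G)

-- For x ∉ Y, cut(Y ∪ {x}) = cut(Y) + cut({x}) − 2·e(x, Y), so the cut shrinks iff x has a neighbour in Y.
hasNeighbourIn : Fin n → VSet n → CutQueryAlg n Bool
hasNeighbourIn x Y = ask ⁅ x ⁆ λ d → ask Y λ c → ask (insert Y x) λ c′ → ret (c′ <ᵇ c + d)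

private
  <ᵇ-doubling : ∀ c e → (c <ᵇ c + e + e) ≡ (0 <ᵇ e)
  <ᵇ-doubling c zero    = <ᵇ-false (subst (λ m → ¬ c < m) (sym (trans (+-identityʳ (c + 0)) (+-identityʳ c))) (n≮n c))
  <ᵇ-doubling c (suc e) = <ᵇ-true (≤-trans (m<m+n c z<s) (m≤m+n (c + suc e) (suc e)))

hasNeighbourIn-correct : (G : Graph n) (x : Fin n) (Y : VSet n) → Y x ≡ false →
                         run (hasNeighbourIn x Y) G ≡ (0 <ᵇ edgesTo (adj G) x Y)
hasNeighbourIn-correct G x Y x∉Y = begin
  cutValue G (insert Y x) <ᵇ cutValue G Y + cutValue G ⁅ x ⁆
    ≡⟨ cong₂ _<ᵇ_ (cutValue≡crossing G (insert Y x))
                  (cong₂ _+_ (cutValue≡crossing G Y) (cutValue≡crossing G ⁅ x ⁆)) ⟩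
  crossing A (insert Y x) <ᵇ crossing A Y + crossing A ⁅ x ⁆
    ≡⟨ cong (crossing A (insert Y x) <ᵇ_) (crossing-insert A (adj-sym G) x Y x∉Y) ⟨
  crossing A (insert Y x) <ᵇ crossing A (insert Y x) + edgesTo A x Y + edgesTo A x Y
    ≡⟨ <ᵇ-doubling (crossing A (insert Y x)) (edgesTo A x Y) ⟩
  0 <ᵇ edgesTo A x Y
    ∎
  where
  open ≡-Reasoning
  A = adj G

hasNeighbourIn-true : (G : Graph n) (x : Fin n) (Y : VSet n) → Y x ≡ false →
                      run (hasNeighbourIn x Y) G ≡ true → 0 < edgesTo (adj G) x Y
hasNeighbourIn-true G x Y x∉Y found = <ᵇ-sound (trans (sym (hasNeighbourIn-correct G x Y x∉Y)) found)

hasNeighbourIn-false : (G : Graph n) (x : Fin n) (Y : VSet n) → Y x ≡ false →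
                       run (hasNeighbourIn x Y) G ≡ false → edgesTo (adj G) x Y ≡ 0
hasNeighbourIn-false G x Y x∉Y none = 0≮ᵇ (trans (sym (hasNeighbourIn-correct G x Y x∉Y)) none)
  where
  0≮ᵇ : ∀ {e} → (0 <ᵇ e) ≡ false → e ≡ 0
  0≮ᵇ {zero} _ = refl

Found : (Fin n → Bool) → Maybe (Fin n) → Set
Found p (just i) = p i ≡ true
Found p nothing  = ∀ i → p i ≡ false

firstWhere : (Fin n → Bool) → Maybe (Fin n)
firstWhere p with any? (λ i → p i ≟ᴮ true)
... | yes (i , _) = just i
... | no  _       = nothing

firstWhere-found : (p : Fin n → Bool) → Found p (firstWhere p)
firstWhere-found p with any? (λ i → p i ≟ᴮ true)
... | yes (i , pi≡true) = pi≡true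
... | no  ∄i            = λ i → ¬-not (λ pi≡true → ∄i (i , pi≡true))

inRange : ℕ → ℕ → ℕ → Bool
inRange lo w i = (lo ≤ᵇ i) ∧ (i <ᵇ lo + w)

inRange-1 : ∀ {lo i} → inRange lo 1 i ≡ true → i ≡ lo
inRange-1 {lo} {i} i∈range =
  ≤-antisym (≤-pred (subst (i <_) (+-comm lo 1) (<ᵇ-sound (∧-true-r i∈range))))
            (≤ᵇ-sound (∧-true-l i∈range))

𝟙-inRange-split : ∀ lo w i → 𝟙 (inRange lo (w + w) i) ≡ 𝟙 (inRange lo w i) + 𝟙 (inRange (lo + w) w i)
𝟙-inRange-split lo w i with lo ≤? i | i <? lo + w
... | no lo≰i | _
  rewrite ≤ᵇ-false lo≰i | ≤ᵇ-false {lo + w} {i} (lo≰i ∘ ≤-trans (m≤m+n lo w)) = refl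
... | yes lo≤i | yes i<lo+w
  rewrite ≤ᵇ-true lo≤i | <ᵇ-true i<lo+w | ≤ᵇ-false {lo + w} {i} (<⇒≱ i<lo+w)
        | <ᵇ-true {i} {lo + (w + w)} (<-≤-trans i<lo+w (+-monoʳ-≤ lo (m≤m+n w w))) = refl
... | yes lo≤i | no i≮lo+w
  rewrite ≤ᵇ-true lo≤i | <ᵇ-false i≮lo+w | ≤ᵇ-true {lo + w} {i} (≮⇒≥ i≮lo+w) | +-assoc lo w w = refl

n<2^logn : ∀ n → n < 2 ^ logn n
n<2^logn n with n <? 2 ^ logn n
... | yes n<2^L = n<2^L
... | no  n≮2^L = contradiction
  (subst (_≤ ⌊log₂ n ⌋) (⌊log₂[2^n]⌋≡n (logn n)) (⌊log₂⌋-mono-≤ (≮⇒≥ n≮2^L))) (n≮n ⌊log₂ n ⌋)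

window : VSet n → ℕ → ℕ → VSet n
window X lo j v = X v ∧ inRange lo (2 ^ j) (toℕ v)

private
  𝟙-∧∧-split : ∀ a x {r r₁ r₂} → 𝟙 r ≡ 𝟙 r₁ + 𝟙 r₂ → 𝟙 (a ∧ x ∧ r) ≡ 𝟙 (a ∧ x ∧ r₁) + 𝟙 (a ∧ x ∧ r₂)
  𝟙-∧∧-split true  true  split = split
  𝟙-∧∧-split true  false _     = refl
  𝟙-∧∧-split false _     _     = refl

edgesTo-window-split : (A : Fin n → Fin n → Bool) (x : Fin n) (X : VSet n) (lo j : ℕ) →
  edgesTo A x (window X lo (suc j)) ≡ edgesTo A x (window X lo j) + edgesTo A x (window X (lo + 2 ^ j) j)
edgesTo-window-split A x X lo j =
  trans (sum-cong-≗ halves) (∑-distrib-+ (λ v → 𝟙 (A x v ∧ window X lo j v)) (λ v → 𝟙 (A x v ∧ window X (lo + 2 ^ j) j v)))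
  where
  2^1+j : 2 ^ suc j ≡ 2 ^ j + 2 ^ j
  2^1+j = cong (2 ^ j +_) (+-identityʳ (2 ^ j))
  halves : ∀ v → 𝟙 (A x v ∧ window X lo (suc j) v)
               ≡ 𝟙 (A x v ∧ window X lo j v) + 𝟙 (A x v ∧ window X (lo + 2 ^ j) j v)
  halves v = 𝟙-∧∧-split (A x v) (X v)
    (trans (cong (λ w → 𝟙 (inRange lo w (toℕ v))) 2^1+j) (𝟙-inRange-split lo (2 ^ j) (toℕ v)))

window-full : ∀ {n} (X : VSet n) v → X v ≡ true → window X 0 (logn n) v ≡ true
window-full {n} X v v∈X rewrite v∈X = <ᵇ-true (<-≤-trans (toℕ<n v) (<⇒≤ (n<2^logn n)))

descend : Fin n → VSet n → ℕ → ℕ → CutQueryAlg n (Maybe (Fin n))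
descend x X zero    lo = ret (firstWhere (window X lo 0))
descend x X (suc j) lo = hasNeighbourIn x (window X lo j) >>= λ found →
  if found then descend x X j lo else descend x X j (lo + 2 ^ j)

findNeighbourIn : Fin n → VSet n → CutQueryAlg n (Maybe (Fin n))
findNeighbourIn {n} x X = hasNeighbourIn x (window X 0 (logn n)) >>= λ found →
  if found then descend x X (logn n) 0 else ret nothing

NeighbourSpec : (Fin n → Fin n → Bool) → Fin n → VSet n → Maybe (Fin n) → Set
NeighbourSpec A x X (just y) = X y ≡ true × A x y ≡ true
NeighbourSpec A x X nothing  = ∀ y → X y ≡ true → A x y ≡ false

module _ (G : Graph n) (x : Fin n) (X : VSet n) (x∉X : X x ≡ false) where
  private
    A = adj G

    x∉window : ∀ lo j → window X lo j x ≡ false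
    x∉window lo j = cong (_∧ _) x∉X

  descend-correct : ∀ j lo → 0 < edgesTo A x (window X lo j) → NeighbourSpec A x X (run (descend x X j lo) G)
  descend-correct zero lo pos = leaf (firstWhere W) (firstWhere-found W)
    where
    W : VSet n
    W = window X lo 0
    v : Fin n
    v = proj₁ (∑-𝟙-pos (λ v → A x v ∧ W v) pos)
    v∈N∩W : (A x v ∧ W v) ≡ true
    v∈N∩W = proj₂ (∑-𝟙-pos (λ v → A x v ∧ W v) pos)
    v∈W : W v ≡ true
    v∈W = ∧-true-r {A x v} v∈N∩W
    leaf : ∀ r → Found W r → NeighbourSpec A x X r
    leaf (just w) w∈W = ∧-true-l w∈W , subst (λ u → A x u ≡ true) (sym w≡v) (∧-true-l {A x v} {W v} v∈N∩W)
      where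
      w≡v : w ≡ v
      w≡v = toℕ-injective (trans (inRange-1 {lo} (∧-true-r {X w} w∈W)) (sym (inRange-1 {lo} (∧-true-r {X v} v∈W))))
    leaf nothing W≡∅ = contradiction (trans (sym v∈W) (W≡∅ v)) λ ()
  descend-correct (suc j) lo pos = halve (run (hasNeighbourIn x W) G) refl
    where
    W : VSet n
    W = window X lo j
    halve : ∀ b → run (hasNeighbourIn x W) G ≡ b →
            NeighbourSpec A x X (run (if b then descend x X j lo else descend x X j (lo + 2 ^ j)) G)
    halve true  found = descend-correct j lo (hasNeighbourIn-true G x W (x∉window lo j) found)
    halve false none  = descend-correct j (lo + 2 ^ j) (subst (0 <_) upper-half pos)
      where
      upper-half : edgesTo A x (window X lo (suc j)) ≡ edgesTo A x (window X (lo + 2 ^ j) j)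
      upper-half = trans (edgesTo-window-split A x X lo j)
                         (cong (_+ edgesTo A x (window X (lo + 2 ^ j) j)) (hasNeighbourIn-false G x W (x∉window lo j) none))

  findNeighbourIn-correct : NeighbourSpec A x X (run (findNeighbourIn x X) G)
  findNeighbourIn-correct = top (run (hasNeighbourIn x W) G) refl
    where
    W : VSet n
    W = window X 0 (logn n)
    top : ∀ b → run (hasNeighbourIn x W) G ≡ b →
          NeighbourSpec A x X (run (if b then descend x X (logn n) 0 else ret nothing) G)
    top true  found = descend-correct (logn n) 0 (hasNeighbourIn-true G x W (x∉window 0 (logn n)) found)
    top false none y y∈X =
      trans (sym (∧-identityʳ (A x y))) (subst (λ b → A x y ∧ b ≡ false) (window-full X y y∈X) y∉W∩N)
      where
      y∉W∩N : (A x y ∧ W y) ≡ false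
      y∉W∩N = ∑-𝟙-zero (λ v → A x v ∧ W v) (hasNeighbourIn-false G x W (x∉window 0 (logn n)) none) y

descend-queries : (G : Graph n) (x : Fin n) (X : VSet n) → ∀ j lo → queries (descend x X j lo) G ≤ 3 * j
descend-queries G x X zero    lo = z≤n
descend-queries G x X (suc j) lo =
  subst (queries (descend x X (suc j) lo) G ≤_) (sym (*-suc 3 j)) (+-monoʳ-≤ 3 (either-half (run (hasNeighbourIn x (window X lo j)) G)))
  where
  either-half : ∀ b → queries (if b then descend x X j lo else descend x X j (lo + 2 ^ j)) G ≤ 3 * j
  either-half true  = descend-queries G x X j lo
  either-half false = descend-queries G x X j (lo + 2 ^ j)

findNeighbourIn-queries : (G : Graph n) (x : Fin n) (X : VSet n) →
                          queries (findNeighbourIn x X) G ≤ 3 + 3 * logn n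
findNeighbourIn-queries {n} G x X = +-monoʳ-≤ 3 (top (run (hasNeighbourIn x (window X 0 (logn n))) G))
  where
  top : ∀ b → queries (if b then descend x X (logn n) 0 else ret nothing) G ≤ 3 * logn n
  top true  = descend-queries G x X (logn n) 0
  top false = z≤n

-- Unit flows and distance labels

Flow : ℕ → Set
Flow n = Fin n → Fin n → Bool

outflow inflow : Flow n → Fin n → ℕ
outflow {n} D w = ∑[ z < n ] 𝟙 (D w z)
inflow  {n} D w = ∑[ z < n ] 𝟙 (D z w)

set : Flow n → Fin n → Fin n → Bool → Flow n
set D x y β i j = if (i == x) ∧ (j == y) then β else D i j

set-here : (D : Flow n) (x y : Fin n) (β : Bool) → set D x y β x y ≡ β
set-here D x y β rewrite ==-refl x | ==-refl y = refl

set-elsewhere : (D : Flow n) (x y : Fin n) (β : Bool) (i j : Fin n) → ¬ (i ≡ x × j ≡ y) → set D x y β i j ≡ D i j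
set-elsewhere D x y β i j ij≢xy with i ≟ᶠ x | j ≟ᶠ y
... | yes refl | yes refl = contradiction (refl , refl) ij≢xy
... | yes _    | no  _    = refl
... | no  _    | _        = refl

set-cases : (D : Flow n) (x y : Fin n) (β : Bool) (i j : Fin n) →
            (i ≡ x × j ≡ y × set D x y β i j ≡ β) ⊎ set D x y β i j ≡ D i j
set-cases D x y β i j with i ≟ᶠ x | j ≟ᶠ y
... | yes refl | yes refl = inj₁ (refl , refl , refl)
... | yes _    | no  _    = inj₂ refl
... | no  _    | _        = inj₂ refl

private
  cancel-𝟙 : ∀ {P Q} c → P + 𝟙 (c ∧ true) ≡ Q + 𝟙 (c ∧ false) → P + 𝟙 c ≡ Q
  cancel-𝟙 true  eq = trans eq (+-identityʳ _)
  cancel-𝟙 false eq = trans eq (+-identityʳ _)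

  add-𝟙 : ∀ {P Q} c → P + 𝟙 (c ∧ false) ≡ Q + 𝟙 (c ∧ true) → P ≡ Q + 𝟙 c
  add-𝟙 true  eq = trans (sym (+-identityʳ _)) eq
  add-𝟙 false eq = trans (sym (+-identityʳ _)) eq

outflow-set : (D : Flow n) (x y : Fin n) (β : Bool) → ∀ {δ} → D x y ≡ δ → ∀ w →
              outflow (set D x y β) w + 𝟙 ((w == x) ∧ δ) ≡ outflow D w + 𝟙 ((w == x) ∧ β)
outflow-set D x y β refl w = by-cases (w ≟ᶠ x)
  where
  open ≡-Reasoning
  by-cases : Dec (w ≡ x) → outflow (set D x y β) w + 𝟙 ((w == x) ∧ D x y) ≡ outflow D w + 𝟙 ((w == x) ∧ β)
  by-cases (no w≢x) rewrite ==-≢ w≢x = refl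
  by-cases (yes refl) = begin
    outflow (set D w y β) w + 𝟙 ((w == w) ∧ D w y) ≡⟨ cong (λ c → outflow (set D w y β) w + 𝟙 (c ∧ D w y)) (==-refl w) ⟩
    outflow (set D w y β) w + 𝟙 (D w y)            ≡⟨ ∑-update y (λ z → 𝟙 (D w z)) (λ z → 𝟙 (set D w y β w z)) unchanged ⟩
    outflow D w + 𝟙 (set D w y β w y)              ≡⟨ cong (λ c → outflow D w + 𝟙 c) (set-here D w y β) ⟩
    outflow D w + 𝟙 β                              ≡⟨ cong (λ c → outflow D w + 𝟙 (c ∧ β)) (==-refl w) ⟨
    outflow D w + 𝟙 ((w == w) ∧ β)                 ∎
    where
    unchanged : ∀ z → ¬ z ≡ y → 𝟙 (set D w y β w z) ≡ 𝟙 (D w z)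
    unchanged z z≢y = cong 𝟙 (set-elsewhere D w y β w z (z≢y ∘ proj₂))

inflow-set : (D : Flow n) (x y : Fin n) (β : Bool) → ∀ {δ} → D x y ≡ δ → ∀ w →
             inflow (set D x y β) w + 𝟙 ((w == y) ∧ δ) ≡ inflow D w + 𝟙 ((w == y) ∧ β)
inflow-set D x y β refl w = by-cases (w ≟ᶠ y)
  where
  open ≡-Reasoning
  by-cases : Dec (w ≡ y) → inflow (set D x y β) w + 𝟙 ((w == y) ∧ D x y) ≡ inflow D w + 𝟙 ((w == y) ∧ β)
  by-cases (no w≢y) = cong₂ _+_
    (sum-cong-≗ λ z → cong 𝟙 (set-elsewhere D x y β z w (w≢y ∘ proj₂)))
    (trans (cong (λ c → 𝟙 (c ∧ D x y)) (==-≢ w≢y)) (sym (cong (λ c → 𝟙 (c ∧ β)) (==-≢ w≢y))))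
  by-cases (yes refl) = begin
    inflow (set D x w β) w + 𝟙 ((w == w) ∧ D x w) ≡⟨ cong (λ c → inflow (set D x w β) w + 𝟙 (c ∧ D x w)) (==-refl w) ⟩
    inflow (set D x w β) w + 𝟙 (D x w)            ≡⟨ ∑-update x (λ z → 𝟙 (D z w)) (λ z → 𝟙 (set D x w β z w)) unchanged ⟩
    inflow D w + 𝟙 (set D x w β x w)              ≡⟨ cong (λ c → inflow D w + 𝟙 c) (set-here D x w β) ⟩
    inflow D w + 𝟙 β                              ≡⟨ cong (λ c → inflow D w + 𝟙 (c ∧ β)) (==-refl w) ⟨
    inflow D w + 𝟙 ((w == w) ∧ β)                 ∎
    where
    unchanged : ∀ z → ¬ z ≡ x → 𝟙 (set D x w β z w) ≡ 𝟙 (D z w)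
    unchanged z z≢x = cong 𝟙 (set-elsewhere D x w β z w (z≢x ∘ proj₁))

push : Flow n → Fin n → Fin n → Flow n
push D a b = if D b a then set D b a false else set D a b true

-- Whether it cancels b → a or adds a → b, a push moves one unit of imbalance from a to b.
push-balance : (D : Flow n) (a b : Fin n) → (D b a ≡ false → D a b ≡ false) → ∀ w →
  outflow (push D a b) w + inflow D w + 𝟙 (w == b) ≡ outflow D w + inflow (push D a b) w + 𝟙 (w == a)
push-balance D a b forward w with D b a in ba
... | true = begin
  O′ + I + 𝟙 (w == b)    ≡⟨ xy∙z≈xz∙y O′ I (𝟙 (w == b)) ⟩
  O′ + 𝟙 (w == b) + I    ≡⟨ cong (_+ I) (cancel-𝟙 (w == b) (outflow-set D b a false ba w)) ⟩
  O + I                  ≡⟨ cong (O +_) (cancel-𝟙 (w == a) (inflow-set D b a false ba w)) ⟨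
  O + (I′ + 𝟙 (w == a))  ≡⟨ +-assoc O I′ (𝟙 (w == a)) ⟨
  O + I′ + 𝟙 (w == a)    ∎
  where
  open ≡-Reasoning
  O : ℕ
  O = outflow D w
  I : ℕ
  I = inflow D w
  O′ : ℕ
  O′ = outflow (set D b a false) w
  I′ : ℕ
  I′ = inflow (set D b a false) w
... | false = begin
  O′ + I + 𝟙 (w == b)                    ≡⟨ cong (λ o → o + I + 𝟙 (w == b)) O′≡O+[w=a] ⟩
  O + 𝟙 (w == a) + I + 𝟙 (w == b)        ≡⟨ +-shuffle O (𝟙 (w == a)) I (𝟙 (w == b)) ⟩
  O + (I + 𝟙 (w == b)) + 𝟙 (w == a)      ≡⟨ cong (λ i → O + i + 𝟙 (w == a)) I′≡I+[w=b] ⟨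
  O + I′ + 𝟙 (w == a)                    ∎
  where
  open ≡-Reasoning
  O : ℕ
  O = outflow D w
  I : ℕ
  I = inflow D w
  O′ : ℕ
  O′ = outflow (set D a b true) w
  I′ : ℕ
  I′ = inflow (set D a b true) w
  O′≡O+[w=a] : O′ ≡ O + 𝟙 (w == a)
  O′≡O+[w=a] = add-𝟙 (w == a) (outflow-set D a b true (forward refl) w)
  I′≡I+[w=b] : I′ ≡ I + 𝟙 (w == b)
  I′≡I+[w=b] = add-𝟙 (w == b) (inflow-set D a b true (forward refl) w)
  +-shuffle : ∀ o a i b → o + a + i + b ≡ o + (i + b) + a
  +-shuffle = solve-∀

push-elsewhere : (D : Flow n) (a b i j : Fin n) → ¬ (i ≡ a × j ≡ b) → ¬ (i ≡ b × j ≡ a) → push D a b i j ≡ D i j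
push-elsewhere D a b i j ij≢ab ij≢ba with D b a
... | true  = set-elsewhere D b a false i j ij≢ba
... | false = set-elsewhere D a b true i j ij≢ab

push-avoiding : (D : Flow n) (a b v i j : Fin n) → (v ≡ a ⊎ v ≡ b) → ¬ i ≡ v → ¬ j ≡ v → push D a b i j ≡ D i j
push-avoiding D a b v i j (inj₁ refl) i≢v j≢v = push-elsewhere D v b i j (i≢v ∘ proj₁) (j≢v ∘ proj₂)
push-avoiding D a b v i j (inj₂ refl) i≢v j≢v = push-elsewhere D a v i j (j≢v ∘ proj₂) (i≢v ∘ proj₁)

raise : (Fin n → ℕ) → Fin n → Fin n → ℕ
raise ℓ x v = if v == x then suc (ℓ x) else ℓ v

raise-here : (ℓ : Fin n → ℕ) (x : Fin n) → raise ℓ x x ≡ suc (ℓ x)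
raise-here ℓ x rewrite ==-refl x = refl

raise-elsewhere : (ℓ : Fin n → ℕ) {x v : Fin n} → ¬ v ≡ x → raise ℓ x v ≡ ℓ v
raise-elsewhere ℓ v≢x rewrite ==-≢ v≢x = refl

-- A unit on b → a can be cancelled, and an unused edge a → b of A can carry one.
residual : (Fin n → Fin n → Bool) → Flow n → Fin n → Fin n → ℕ
residual A D a b = 𝟙 (D b a) + 𝟙 (A a b ∧ not (D a b))

SupportIn : (Fin n → Fin n → Bool) → Flow n → Set
SupportIn A D = ∀ a b → D a b ≡ true → A a b ≡ true

module _ (A : Fin n → Fin n → Bool) where

  push-support : (D : Flow n) (a b : Fin n) → SupportIn A D → 0 < residual A D a b → SupportIn A (push D a b)
  push-support D a b supp r i j with D b a
  ... | true = λ Dij → case (set-cases D b a false i j) Dij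
    where
    case : (i ≡ b × j ≡ a × set D b a false i j ≡ false) ⊎ set D b a false i j ≡ D i j →
           set D b a false i j ≡ true → A i j ≡ true
    case (inj₁ (_ , _ , Dij≡false)) Dij = contradiction (trans (sym Dij) Dij≡false) λ ()
    case (inj₂ unchanged)           Dij = supp i j (trans (sym unchanged) Dij)
  ... | false = λ Dij → case (set-cases D a b true i j) Dij
    where
    case : (i ≡ a × j ≡ b × set D a b true i j ≡ true) ⊎ set D a b true i j ≡ D i j →
           set D a b true i j ≡ true → A i j ≡ true
    case (inj₁ (refl , refl , _)) _   = ∧-true-l (𝟙-pos r)
    case (inj₂ unchanged)         Dij = supp i j (trans (sym unchanged) Dij)

  residual-after-push : (D : Flow n) (a b c d : Fin n) → 0 < residual A D a b →
                        0 < residual A (push D a b) c d → 0 < residual A D c d ⊎ (c ≡ b × d ≡ a)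
  residual-after-push D a b c d r r′ with c ≟ᶠ b ×-dec d ≟ᶠ a | c ≟ᶠ a ×-dec d ≟ᶠ b
  ... | yes cd≡ba | _              = inj₂ cd≡ba
  ... | no  _     | yes (refl , refl) = inj₁ r
  ... | no  cd≢ba | no  cd≢ab      = inj₁ (subst (0 <_) unchanged r′)
    where
    unchanged : residual A (push D a b) c d ≡ residual A D c d
    unchanged = cong₂ (λ p q → 𝟙 p + 𝟙 (A c d ∧ not q))
      (push-elsewhere D a b d c (λ (d≡a , c≡b) → cd≢ba (c≡b , d≡a)) (λ (d≡b , c≡a) → cd≢ab (c≡a , d≡b)))
      (push-elsewhere D a b c d cd≢ab cd≢ba)

  residual-of-reverse : (D : Flow n) (a b : Fin n) → D b a ≡ true → 0 < residual A D a b
  residual-of-reverse D a b ba rewrite ba = s≤s z≤n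

  residual-of-unused : (D : Flow n) (a b : Fin n) → (A a b ∧ not (D a b)) ≡ true → 0 < residual A D a b
  residual-of-unused D a b unused rewrite unused = m≤n+m 1 (𝟙 (D b a))

  residual-forward : (D : Flow n) (a b : Fin n) → 0 < residual A D a b → D b a ≡ false → D a b ≡ false
  residual-forward D a b r ba with D b a | A a b | D a b
  ... | false | _     | false = refl
  ... | false | true  | true  = contradiction r λ ()
  ... | false | false | true  = contradiction r λ ()

  push-reverse : (D : Flow n) (x y : Fin n) → SupportIn A D → 0 < residual A (push D x y) y x
  push-reverse D x y supp with D y x in yx
  ... | true rewrite set-here D y x false | supp y x yx = m≤n+m 1 _
  ... | false rewrite set-here D x y true = s≤s z≤n

  residual-plus-flow : (D : Flow n) → SupportIn A D → ∀ u v → residual A D u v + 𝟙 (D u v) ≡ 𝟙 (A u v) + 𝟙 (D v u)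
  residual-plus-flow D supp u v with D u v in uv
  ... | true rewrite supp u v uv = trans (cong (_+ 1) (+-identityʳ (𝟙 (D v u)))) (+-comm (𝟙 (D v u)) 1)
  ... | false with A u v
  ...   | true  = trans (+-identityʳ _) (+-comm (𝟙 (D v u)) 1)
  ...   | false = trans (+-identityʳ _) (+-identityʳ _)

  ValidLabels : (Fin n → ℕ) → Flow n → Set
  ValidLabels ℓ D = ∀ a b → 0 < residual A D a b → ℓ a ≤ suc (ℓ b)

  push-valid : (ℓ : Fin n → ℕ) (D : Flow n) (a b : Fin n) → ValidLabels ℓ D → 0 < residual A D a b →
               ℓ b ≤ suc (ℓ a) → ValidLabels ℓ (push D a b)
  push-valid ℓ D a b valid r ℓb≤1+ℓa c d r′ with residual-after-push D a b c d r r′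
  ... | inj₁ r₀          = valid c d r₀
  ... | inj₂ (refl , refl) = ℓb≤1+ℓa

  raise-valid : (ℓ : Fin n → ℕ) (D : Flow n) (x : Fin n) → ValidLabels ℓ D →
                (∀ y → 0 < residual A D x y → ¬ suc (ℓ y) ≡ ℓ x) → ValidLabels (raise ℓ x) D
  raise-valid ℓ D x valid no-admissible c d r with c ≟ᶠ x | d ≟ᶠ x
  ... | yes refl | yes refl = n≤1+n _
  ... | yes refl | no  _    = ≤∧≢⇒< (valid x d r) (λ ℓx≡1+ℓd → no-admissible d r (sym ℓx≡1+ℓd))
  ... | no  _    | yes refl = ≤-trans (valid c x r) (n≤1+n _)
  ... | no  _    | no  _    = valid c d r

private
  rebalance : ∀ O O′ I I′ {T S₁ S₂ a b} → O′ + I + b ≡ O + I′ + a → O + T + a ≡ I + S₁ + S₂ →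
              O′ + T + b ≡ I′ + S₁ + S₂
  rebalance O O′ I I′ {T} {S₁} {S₂} {a} {b} balance conserved = +-cancelʳ-≡ I _ _ (begin
    O′ + T + b + I        ≡⟨ shuffle O′ T b I ⟩
    O′ + I + b + T        ≡⟨ cong (_+ T) balance ⟩
    O + I′ + a + T        ≡⟨ shuffle O I′ a T ⟩
    O + T + a + I′        ≡⟨ cong (_+ I′) conserved ⟩
    I + S₁ + S₂ + I′      ≡⟨ rotate I S₁ S₂ I′ ⟩
    I′ + S₁ + S₂ + I      ∎)
    where
    open ≡-Reasoning
    shuffle : ∀ p q r u → p + q + r + u ≡ p + u + r + q
    shuffle = solve-∀
    rotate : ∀ p q r u → p + q + r + u ≡ u + q + r + p
    rotate = solve-∀

-- Flow across a cut and the layer bound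

transpose : Flow n → Flow n
transpose D u v = D v u

private
  𝟙-split-tail : ∀ su sv d → 𝟙 su * 𝟙 d ≡ 𝟙 (d ∧ su ∧ sv) + 𝟙 (d ∧ su ∧ not sv)
  𝟙-split-tail true  true  true  = refl
  𝟙-split-tail true  false true  = refl
  𝟙-split-tail false _     true  = refl
  𝟙-split-tail true  _     false = refl
  𝟙-split-tail false _     false = refl

  𝟙-split-head : ∀ su sv d → 𝟙 sv * 𝟙 d ≡ 𝟙 (d ∧ su ∧ sv) + 𝟙 (d ∧ sv ∧ not su)
  𝟙-split-head true  true  true  = refl
  𝟙-split-head false true  true  = refl
  𝟙-split-head true  false true  = refl
  𝟙-split-head false false true  = refl
  𝟙-split-head _     true  false = refl
  𝟙-split-head _     false false = refl

inside : VSet n → Flow n → ℕ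
inside S D = ∑∑ (λ u v → 𝟙 (D u v ∧ S u ∧ S v))

∑-outflow : (S : VSet n) (D : Flow n) → ∑[ w < n ] (𝟙 (S w) * outflow D w) ≡ inside S D + crossing D S
∑-outflow {n} S D = begin
  ∑[ u < n ] (𝟙 (S u) * outflow D u)
    ≡⟨ sum-cong-≗ (λ u → *-distribˡ-sum (𝟙 (S u)) (λ v → 𝟙 (D u v))) ⟩
  ∑∑ (λ u v → 𝟙 (S u) * 𝟙 (D u v))
    ≡⟨ ∑∑-cong (λ u v → 𝟙-split-tail (S u) (S v) (D u v)) ⟩
  ∑∑ (λ u v → 𝟙 (D u v ∧ S u ∧ S v) + 𝟙 (D u v ∧ leaves S u v))
    ≡⟨ ∑∑-distrib-+ (λ u v → 𝟙 (D u v ∧ S u ∧ S v)) (λ u v → 𝟙 (D u v ∧ leaves S u v)) ⟩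
  inside S D + crossing D S
    ∎
  where open ≡-Reasoning

∑-inflow : (S : VSet n) (D : Flow n) → ∑[ w < n ] (𝟙 (S w) * inflow D w) ≡ inside S D + crossing (transpose D) S
∑-inflow {n} S D = begin
  ∑[ v < n ] (𝟙 (S v) * inflow D v)
    ≡⟨ sum-cong-≗ (λ v → *-distribˡ-sum (𝟙 (S v)) (λ u → 𝟙 (D u v))) ⟩
  ∑∑ (λ v u → 𝟙 (S v) * 𝟙 (D u v))
    ≡⟨ ∑∑-transpose (λ v u → 𝟙 (S v) * 𝟙 (D u v)) ⟩
  ∑∑ (λ u v → 𝟙 (S v) * 𝟙 (D u v))
    ≡⟨ ∑∑-cong (λ u v → 𝟙-split-head (S u) (S v) (D u v)) ⟩
  ∑∑ (λ u v → 𝟙 (D u v ∧ S u ∧ S v) + 𝟙 (D u v ∧ leaves S v u))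
    ≡⟨ ∑∑-distrib-+ (λ u v → 𝟙 (D u v ∧ S u ∧ S v)) (λ u v → 𝟙 (D u v ∧ leaves S v u)) ⟩
  inside S D + ∑∑ (λ u v → 𝟙 (D u v ∧ leaves S v u))
    ≡⟨ cong (inside S D +_) (∑∑-transpose (λ u v → 𝟙 (D u v ∧ leaves S v u))) ⟩
  inside S D + crossing (transpose D) S
    ∎
  where open ≡-Reasoning

module _ (s t : Fin n) where

  -- D carries φ units of flow from s to t and, unless c = s, one more unit from s to c.
  Conserves : Flow n → ℕ → Fin n → Set
  Conserves D φ c = ∀ w → outflow D w + 𝟙 (w == t) * φ + 𝟙 (w == c) ≡ inflow D w + 𝟙 (w == s) * φ + 𝟙 (w == s)

  net-flow-across-cut : (D : Flow n) (φ : ℕ) (S : VSet n) → S s ≡ true → S t ≡ false →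
                        Conserves D φ s → crossing D S ≡ crossing (transpose D) S + φ
  net-flow-across-cut D φ S s∈S t∉S conserves = +-cancelˡ-≡ (inside S D) _ _ (begin
    inside S D + crossing D S
      ≡⟨ ∑-outflow S D ⟨
    ∑[ w < n ] (𝟙 (S w) * outflow D w)
      ≡⟨ +-identityʳ _ ⟨
    ∑[ w < n ] (𝟙 (S w) * outflow D w) + 0
      ≡⟨ cong (∑[ w < n ] (𝟙 (S w) * outflow D w) +_) (trans (∑-at t φ) (cong (λ b → 𝟙 b * φ) t∉S)) ⟨
    ∑[ w < n ] (𝟙 (S w) * outflow D w) + ∑[ w < n ] (𝟙 (S w) * (𝟙 (w == t) * φ))
      ≡⟨ ∑-weighted-+ (outflow D) (λ w → 𝟙 (w == t) * φ) ⟨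
    ∑[ w < n ] (𝟙 (S w) * (outflow D w + 𝟙 (w == t) * φ))
      ≡⟨ sum-cong-≗ (λ w → cong (𝟙 (S w) *_) (+-cancelʳ-≡ (𝟙 (w == s)) _ _ (conserves w))) ⟩
    ∑[ w < n ] (𝟙 (S w) * (inflow D w + 𝟙 (w == s) * φ))
      ≡⟨ ∑-weighted-+ (inflow D) (λ w → 𝟙 (w == s) * φ) ⟩
    ∑[ w < n ] (𝟙 (S w) * inflow D w) + ∑[ w < n ] (𝟙 (S w) * (𝟙 (w == s) * φ))
      ≡⟨ cong₂ _+_ (∑-inflow S D) (trans (∑-at s φ) (trans (cong (λ b → 𝟙 b * φ) s∈S) (+-identityʳ φ))) ⟩
    inside S D + crossing (transpose D) S + φ
      ≡⟨ +-assoc (inside S D) (crossing (transpose D) S) φ ⟩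
    inside S D + (crossing (transpose D) S + φ)
      ∎)
    where
    open ≡-Reasoning
    ∑-weighted-+ : (f g : Fin n → ℕ) → ∑[ w < n ] (𝟙 (S w) * (f w + g w)) ≡ ∑[ w < n ] (𝟙 (S w) * f w) + ∑[ w < n ] (𝟙 (S w) * g w)
    ∑-weighted-+ f g = trans (sum-cong-≗ (λ w → *-distribˡ-+ (𝟙 (S w)) (f w) (g w)))
                             (∑-distrib-+ (λ w → 𝟙 (S w) * f w) (λ w → 𝟙 (S w) * g w))
    ∑-at : ∀ x c → ∑[ w < n ] (𝟙 (S w) * (𝟙 (w == x) * c)) ≡ 𝟙 (S x) * c
    ∑-at x c = trans (sum-cong-≗ (λ w → x∙yz≈y∙xz (𝟙 (S w)) (𝟙 (w == x)) c)) (∑-pick x (λ w → 𝟙 (S w) * c))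
      where
      x∙yz≈y∙xz : ∀ a b c → a * (b * c) ≡ b * (a * c)
      x∙yz≈y∙xz = solve-∀

  conserves-complete : (D : Flow n) (φ : ℕ) → Conserves D φ t → Conserves D (suc φ) s
  conserves-complete D φ conserves w = begin
    outflow D w + 𝟙 (w == t) * suc φ + 𝟙 (w == s)             ≡⟨ open-t (outflow D w) (𝟙 (w == t)) φ (𝟙 (w == s)) ⟩
    outflow D w + 𝟙 (w == t) * φ + 𝟙 (w == t) + 𝟙 (w == s)    ≡⟨ cong (_+ 𝟙 (w == s)) (conserves w) ⟩
    inflow D w + 𝟙 (w == s) * φ + 𝟙 (w == s) + 𝟙 (w == s)     ≡⟨ close-s (inflow D w) (𝟙 (w == s)) φ ⟩
    inflow D w + 𝟙 (w == s) * suc φ + 𝟙 (w == s)              ∎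
    where
    open ≡-Reasoning
    open-t : ∀ o a φ b → o + a * suc φ + b ≡ o + a * φ + a + b
    open-t = solve-∀
    close-s : ∀ i b φ → i + b * φ + b + b ≡ i + b * suc φ + b
    close-s = solve-∀

  value≤outflow : ¬ s ≡ t → (D : Flow n) (φ : ℕ) → Conserves D φ s → φ ≤ outflow D s
  value≤outflow s≢t D φ conserves =
    ≤-trans (m≤n+m φ (inflow D s)) (≤-reflexive (sym (+-cancelʳ-≡ 1 (outflow D s) (inflow D s + φ) at-s)))
    where
    at-s : outflow D s + 1 ≡ inflow D s + φ + 1
    at-s = begin
      outflow D s + 1                                      ≡⟨ cong (_+ 1) (+-identityʳ _) ⟨
      outflow D s + 0 * φ + 1                              ≡⟨ cong₂ (λ b c → outflow D s + 𝟙 b * φ + 𝟙 c) (==-≢ s≢t) (==-refl s) ⟨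
      outflow D s + 𝟙 (s == t) * φ + 𝟙 (s == s)            ≡⟨ conserves s ⟩
      inflow D s + 𝟙 (s == s) * φ + 𝟙 (s == s)             ≡⟨ cong (λ b → inflow D s + 𝟙 b * φ + 𝟙 b) (==-refl s) ⟩
      inflow D s + 1 * φ + 1                               ≡⟨ cong (λ m → inflow D s + m + 1) (*-identityˡ φ) ⟩
      inflow D s + φ + 1                                   ∎
      where open ≡-Reasoning

argmin : {d : ℕ} (x : Fin (suc d) → ℕ) → ∃ λ j → ∀ i → x j ≤ x i
argmin {zero}  x = zero , λ { zero → ≤-refl }
argmin {suc d} x with argmin (x ∘ suc)
... | j , min with x zero ≤? x (suc j)
...   | yes x₀≤ = zero  , λ { zero → ≤-refl ; (suc i) → ≤-trans x₀≤ (min i) }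
...   | no  x₀≰ = suc j , λ { zero → <⇒≤ (≰⇒> x₀≰) ; (suc i) → min i }

4*m*n≤[m+n]² : ∀ a b → 4 * (a * b) ≤ (a + b) * (a + b)
4*m*n≤[m+n]² a b with ≤-total a b
... | inj₁ a≤b = let c , a+c≡b = m≤n⇒∃[o]m+o≡n a≤b in
  subst (λ b → 4 * (a * b) ≤ (a + b) * (a + b)) a+c≡b (≤-trans (m≤m+n _ (c * c)) (≤-reflexive (square a c)))
  where
  square : ∀ a c → 4 * (a * (a + c)) + c * c ≡ (a + (a + c)) * (a + (a + c))
  square = solve-∀
... | inj₂ b≤a = let c , b+c≡a = m≤n⇒∃[o]m+o≡n b≤a in
  subst (λ a → 4 * (a * b) ≤ (a + b) * (a + b)) b+c≡a (≤-trans (m≤m+n _ (c * c)) (≤-reflexive (square b c)))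
  where
  square : ∀ b c → 4 * ((b + c) * b) + c * c ≡ ((b + c) + b) * ((b + c) + b)
  square = solve-∀

-- At the index j minimising a j + a (j+1), AM-GM gives 2(K+1) ≤ (a j + a (j+1))², while d (a j + a (j+1)) ≤ 2N.
consecutive-products-bound : ∀ d N K (a : ℕ → ℕ) → (∀ (i : Fin d) → suc K ≤ 2 * (a (suc (toℕ i)) * a (toℕ i))) →
                             ∑[ i < d ] (a (toℕ i) + a (suc (toℕ i))) ≤ 2 * N → d * d * suc K ≤ 2 * (N * N)
consecutive-products-bound zero    N K a products total = z≤n
consecutive-products-bound (suc d) N K a products total = *-cancelˡ-≤ 2 (begin
  2 * (D * D * suc K)      ≡⟨ reorder D (suc K) ⟩
  D * D * (2 * suc K)      ≤⟨ *-monoʳ-≤ (D * D) 2[K+1]≤x²  ⟩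
  D * D * (x j * x j)      ≡⟨ regroup D (x j) ⟩
  (D * x j) * (D * x j)    ≤⟨ *-mono-≤ D*x≤2N D*x≤2N ⟩
  2 * N * (2 * N)          ≡⟨ double-square N ⟩
  2 * (2 * (N * N))        ∎)
  where
  open ≤-Reasoning
  D : ℕ
  D = suc d
  x : Fin D → ℕ
  x i = a (toℕ i) + a (suc (toℕ i))
  j : Fin D
  j = proj₁ (argmin x)
  2[K+1]≤x² : 2 * suc K ≤ x j * x j
  2[K+1]≤x² = ≤-trans (*-monoʳ-≤ 2 (products j))
    (≤-trans (≤-reflexive (twice-twice (a (suc (toℕ j))) (a (toℕ j)))) (4*m*n≤[m+n]² (a (toℕ j)) (a (suc (toℕ j)))))
    where
    twice-twice : ∀ p q → 2 * (2 * (p * q)) ≡ 4 * (q * p)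
    twice-twice = solve-∀
  D*x≤2N : D * x j ≤ 2 * N
  D*x≤2N = ≤-trans (≤-trans (≤-reflexive (sym (∑-const D (x j)))) (∑-mono-≤ (proj₂ (argmin x)))) total
  reorder : ∀ p q → 2 * (p * p * q) ≡ p * p * (2 * q)
  reorder = solve-∀
  regroup : ∀ p q → p * p * (q * q) ≡ (p * q) * (p * q)
  regroup = solve-∀
  double-square : ∀ m → 2 * m * (2 * m) ≡ 2 * (2 * (m * m))
  double-square = solve-∀

∑[k≡ᵇi]≤1 : ∀ d k → ∑[ i < d ] 𝟙 (k ≡ᵇ toℕ i) ≤ 1
∑[k≡ᵇi]≤1 zero    k       = z≤n
∑[k≡ᵇi]≤1 (suc d) zero    = ≤-reflexive (cong suc (trans (∑-const d 0) (*-zeroʳ d)))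
∑[k≡ᵇi]≤1 (suc d) (suc k) = ∑[k≡ᵇi]≤1 d k

module _ (A : Fin n → Fin n → Bool) (s : Fin n) where

  -- The stack of the search, from the head c back to s: each step climbs one label along a residual arc,
  -- the reverse of an arc the search advanced along.
  BackPath : Flow n → (Fin n → ℕ) → Fin n → List (Fin n) → Set
  BackPath D ℓ c []      = c ≡ s
  BackPath D ℓ c (u ∷ p) = ℓ u ≡ suc (ℓ c) × 0 < residual A D c u × BackPath D ℓ u p

  backPath-length : (D : Flow n) (ℓ : Fin n → ℕ) (c : Fin n) (p : List (Fin n)) →
                    BackPath D ℓ c p → ℓ s ≡ length p + ℓ c
  backPath-length D ℓ c []      c≡s            = cong ℓ (sym c≡s)
  backPath-length D ℓ c (u ∷ p) (ℓu≡1+ℓc , _ , path) =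
    trans (backPath-length D ℓ u p path) (trans (cong (length p +_) ℓu≡1+ℓc) (+-suc (length p) (ℓ c)))

  backPath-flow : (D D′ : Flow n) (ℓ : Fin n → ℕ) (c : Fin n) (p : List (Fin n)) (m : ℕ) → m ≤ ℓ c →
                  (∀ i j → m ≤ ℓ i → m ≤ ℓ j → D′ i j ≡ D i j) → BackPath D ℓ c p → BackPath D′ ℓ c p
  backPath-flow D D′ ℓ c []      m m≤ℓc agree path = path
  backPath-flow D D′ ℓ c (u ∷ p) m m≤ℓc agree (ℓu≡1+ℓc , r , path) =
    ℓu≡1+ℓc , subst (0 <_) (sym unchanged) r , backPath-flow D D′ ℓ u p m m≤ℓu agree path
    where
    m≤ℓu : m ≤ ℓ u
    m≤ℓu = ≤-trans m≤ℓc (≤-trans (n≤1+n _) (≤-reflexive (sym ℓu≡1+ℓc)))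
    unchanged = cong₂ (λ p q → 𝟙 p + 𝟙 (A c u ∧ not q)) (agree u c m≤ℓu m≤ℓc) (agree c u m≤ℓc m≤ℓu)

  backPath-labels : (D : Flow n) (ℓ ℓ′ : Fin n → ℕ) (c : Fin n) (p : List (Fin n)) (m : ℕ) → m ≤ ℓ c →
                    (∀ v → m ≤ ℓ v → ℓ′ v ≡ ℓ v) → BackPath D ℓ c p → BackPath D ℓ′ c p
  backPath-labels D ℓ ℓ′ c []      m m≤ℓc agree path = path
  backPath-labels D ℓ ℓ′ c (u ∷ p) m m≤ℓc agree (ℓu≡1+ℓc , r , path) =
    trans (agree u m≤ℓu) (trans ℓu≡1+ℓc (cong suc (sym (agree c m≤ℓc)))) , r ,
    backPath-labels D ℓ ℓ′ u p m m≤ℓu agree path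
    where
    m≤ℓu : m ≤ ℓ u
    m≤ℓu = ≤-trans m≤ℓc (≤-trans (n≤1+n _) (≤-reflexive (sym ℓu≡1+ℓc)))

module _ (A : Fin n → Fin n → Bool) (s t : Fin n) where

  push-conserves : (D : Flow n) (φ : ℕ) (a b : Fin n) → 0 < residual A D a b →
                   Conserves s t D φ a → Conserves s t (push D a b) φ b
  push-conserves D φ a b r conserves w =
    rebalance (outflow D w) (outflow (push D a b) w) (inflow D w) (inflow (push D a b) w)
              (push-balance D a b (residual-forward A D a b r) w) (conserves w)

  residualAcross : Flow n → VSet n → ℕ
  residualAcross D S = ∑∑ (λ u v → residual A D u v * 𝟙 (leaves S u v))

  residual-across-cut : (D : Flow n) (φ : ℕ) (S : VSet n) → SupportIn A D → S s ≡ true → S t ≡ false →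
                        Conserves s t D φ s → residualAcross D S + φ ≡ crossing A S
  residual-across-cut D φ S supp s∈S t∉S conserves = +-cancelʳ-≡ (crossing (transpose D) S) _ _ (begin
    residualAcross D S + φ + crossing (transpose D) S
      ≡⟨ +-assoc (residualAcross D S) φ _ ⟩
    residualAcross D S + (φ + crossing (transpose D) S)
      ≡⟨ cong (residualAcross D S +_) (trans (+-comm φ _) (sym (net-flow-across-cut s t D φ S s∈S t∉S conserves))) ⟩
    residualAcross D S + crossing D S
      ≡⟨ ∑∑-distrib-+ (λ u v → residual A D u v * 𝟙 (leaves S u v)) (λ u v → 𝟙 (D u v ∧ leaves S u v)) ⟨
    ∑∑ (λ u v → residual A D u v * 𝟙 (leaves S u v) + 𝟙 (D u v ∧ leaves S u v))
      ≡⟨ ∑∑-cong exchange ⟩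
    ∑∑ (λ u v → 𝟙 (A u v ∧ leaves S u v) + 𝟙 (D v u ∧ leaves S u v))
      ≡⟨ ∑∑-distrib-+ (λ u v → 𝟙 (A u v ∧ leaves S u v)) (λ u v → 𝟙 (D v u ∧ leaves S u v)) ⟩
    crossing A S + crossing (transpose D) S
      ∎)
    where
    open ≡-Reasoning
    exchange : ∀ u v → residual A D u v * 𝟙 (leaves S u v) + 𝟙 (D u v ∧ leaves S u v)
                     ≡ 𝟙 (A u v ∧ leaves S u v) + 𝟙 (D v u ∧ leaves S u v)
    exchange u v = begin
      residual A D u v * L + 𝟙 (D u v ∧ leaves S u v) ≡⟨ cong (residual A D u v * L +_) (𝟙-∧ (D u v) _) ⟩
      residual A D u v * L + 𝟙 (D u v) * L           ≡⟨ *-distribʳ-+ L (residual A D u v) (𝟙 (D u v)) ⟨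
      (residual A D u v + 𝟙 (D u v)) * L             ≡⟨ cong (_* L) (residual-plus-flow A D supp u v) ⟩
      (𝟙 (A u v) + 𝟙 (D v u)) * L                    ≡⟨ *-distribʳ-+ L (𝟙 (A u v)) (𝟙 (D v u)) ⟩
      𝟙 (A u v) * L + 𝟙 (D v u) * L                  ≡⟨ cong₂ _+_ (𝟙-∧ (A u v) _) (𝟙-∧ (D v u) _) ⟨
      𝟙 (A u v ∧ leaves S u v) + 𝟙 (D v u ∧ leaves S u v) ∎
      where
      L : ℕ
      L = 𝟙 (leaves S u v)

  above : (Fin n → ℕ) → ℕ → VSet n
  above ℓ i v = i <ᵇ ℓ v

  layer : (Fin n → ℕ) → ℕ → ℕ
  layer ℓ i = ∑[ v < n ] 𝟙 (ℓ v ≡ᵇ i)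

  residual-across-above : (ℓ : Fin n → ℕ) (D : Flow n) (i : ℕ) → ValidLabels A ℓ D →
                          residualAcross D (above ℓ i) ≤ 2 * (layer ℓ (suc i) * layer ℓ i)
  residual-across-above ℓ D i valid = begin
    residualAcross D (above ℓ i)
      ≤⟨ ∑∑-mono-≤ arc-bound ⟩
    ∑∑ (λ u v → 2 * (𝟙 (ℓ u ≡ᵇ suc i) * 𝟙 (ℓ v ≡ᵇ i)))
      ≡⟨ sum-cong-≗ (λ u → *-distribˡ-sum 2 (λ v → 𝟙 (ℓ u ≡ᵇ suc i) * 𝟙 (ℓ v ≡ᵇ i))) ⟨
    ∑[ u < n ] (2 * ∑[ v < n ] (𝟙 (ℓ u ≡ᵇ suc i) * 𝟙 (ℓ v ≡ᵇ i)))
      ≡⟨ *-distribˡ-sum 2 (λ u → ∑[ v < n ] (𝟙 (ℓ u ≡ᵇ suc i) * 𝟙 (ℓ v ≡ᵇ i))) ⟨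
    2 * ∑[ u < n ] ∑[ v < n ] (𝟙 (ℓ u ≡ᵇ suc i) * 𝟙 (ℓ v ≡ᵇ i))
      ≡⟨ cong (2 *_) (sum-cong-≗ (λ u → *-distribˡ-sum (𝟙 (ℓ u ≡ᵇ suc i)) (λ v → 𝟙 (ℓ v ≡ᵇ i)))) ⟨
    2 * ∑[ u < n ] (𝟙 (ℓ u ≡ᵇ suc i) * layer ℓ i)
      ≡⟨ cong (2 *_) (*-distribʳ-sum (layer ℓ i) (λ u → 𝟙 (ℓ u ≡ᵇ suc i))) ⟨
    2 * (layer ℓ (suc i) * layer ℓ i)
      ∎
    where
    open ≤-Reasoning
    arc-bound : ∀ u v → residual A D u v * 𝟙 (leaves (above ℓ i) u v) ≤ 2 * (𝟙 (ℓ u ≡ᵇ suc i) * 𝟙 (ℓ v ≡ᵇ i))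
    arc-bound u v with i <ᵇ ℓ u in u-above | i <ᵇ ℓ v in v-above | residual A D u v in r
    ... | false | _     | ρ     = ≤-trans (≤-reflexive (*-zeroʳ ρ)) z≤n
    ... | true  | true  | ρ     = ≤-trans (≤-reflexive (*-zeroʳ ρ)) z≤n
    ... | true  | false | zero  = z≤n
    ... | true  | false | suc k = begin
      suc k * 1                                 ≡⟨ *-identityʳ (suc k) ⟩
      suc k                                     ≡⟨ r ⟨
      residual A D u v                          ≤⟨ +-mono-≤ (𝟙≤1 (D v u)) (𝟙≤1 (A u v ∧ not (D u v))) ⟩
      2                                         ≡⟨ cong₂ (λ p q → 2 * (𝟙 p * 𝟙 q)) (≡ᵇ-true ℓu≡1+i) (≡ᵇ-true ℓv≡i) ⟨
      2 * (𝟙 (ℓ u ≡ᵇ suc i) * 𝟙 (ℓ v ≡ᵇ i))    ∎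
      where
      i<ℓu : i < ℓ u
      i<ℓu = <ᵇ-sound u-above
      ℓv≤i : ℓ v ≤ i
      ℓv≤i = ≮⇒≥ (does-false (i <? ℓ v) v-above)
      ℓu≤1+ℓv : ℓ u ≤ suc (ℓ v)
      ℓu≤1+ℓv = valid u v (subst (0 <_) (sym r) z<s)
      ℓu≡1+i : ℓ u ≡ suc i
      ℓu≡1+i = ≤-antisym (≤-trans ℓu≤1+ℓv (s≤s ℓv≤i)) i<ℓu
      ℓv≡i : ℓ v ≡ i
      ℓv≡i = ≤-antisym ℓv≤i (≤-pred (≤-trans i<ℓu ℓu≤1+ℓv))

  ∑-layers≤n : (ℓ : Fin n → ℕ) (d : ℕ) → ∑[ i < d ] layer ℓ (toℕ i) ≤ n
  ∑-layers≤n ℓ d = begin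
    ∑[ i < d ] ∑[ v < n ] 𝟙 (ℓ v ≡ᵇ toℕ i)  ≡⟨ ∑-comm {d} {n} (λ i v → 𝟙 (ℓ v ≡ᵇ toℕ i)) ⟩
    ∑[ v < n ] ∑[ i < d ] 𝟙 (ℓ v ≡ᵇ toℕ i)  ≤⟨ ∑-mono-≤ (λ v → ∑[k≡ᵇi]≤1 d (ℓ v)) ⟩
    ∑[ v < n ] 1                             ≡⟨ ∑-const n 1 ⟩
    n * 1                                    ≡⟨ *-identityʳ n ⟩
    n                                        ∎
    where open ≤-Reasoning

  -- For i < ℓ s the cut "label > i" separates s from t, so its residual capacity is at least f − φ > Δ.
  labels-bound : (D : Flow n) (φ : ℕ) (ℓ : Fin n → ℕ) (f Δ : ℕ) → SupportIn A D → Conserves s t D φ s →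
                 ValidLabels A ℓ D → ℓ t ≡ 0 → (∀ S → S s ≡ true → S t ≡ false → f ≤ crossing A S) →
                 suc (φ + Δ) ≤ f → ℓ s * ℓ s * suc Δ ≤ 2 * (n * n)
  labels-bound D φ ℓ f Δ supp conserves valid ℓt≡0 f≤cut φ+Δ<f =
    consecutive-products-bound (ℓ s) n Δ (layer ℓ) products total
    where
    open ≤-Reasoning
    products : ∀ (i : Fin (ℓ s)) → suc Δ ≤ 2 * (layer ℓ (suc (toℕ i)) * layer ℓ (toℕ i))
    products i = ≤-trans Δ<residual (residual-across-above ℓ D (toℕ i) valid)
      where
      S : VSet n
      S = above ℓ (toℕ i)
      s∈S : S s ≡ true
      s∈S = <ᵇ-true (toℕ<n i)
      t∉S : S t ≡ false
      t∉S = subst (λ m → (toℕ i <ᵇ m) ≡ false) (sym ℓt≡0) (<ᵇ-false {toℕ i} {0} λ ())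
      Δ<residual : suc Δ ≤ residualAcross D S
      Δ<residual = +-cancelʳ-≤ φ (suc Δ) (residualAcross D S) (begin
        suc Δ + φ             ≡⟨ cong suc (+-comm Δ φ) ⟩
        suc (φ + Δ)           ≤⟨ φ+Δ<f ⟩
        f                     ≤⟨ f≤cut S s∈S t∉S ⟩
        crossing A S          ≡⟨ residual-across-cut D φ S supp s∈S t∉S conserves ⟨
        residualAcross D S + φ ∎)
    total : ∑[ i < ℓ s ] (layer ℓ (toℕ i) + layer ℓ (suc (toℕ i))) ≤ 2 * n
    total = begin
      ∑[ i < ℓ s ] (layer ℓ (toℕ i) + layer ℓ (suc (toℕ i)))
        ≡⟨ ∑-distrib-+ {ℓ s} (λ i → layer ℓ (toℕ i)) (λ i → layer ℓ (suc (toℕ i))) ⟩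
      ∑[ i < ℓ s ] layer ℓ (toℕ i) + ∑[ i < ℓ s ] layer ℓ (suc (toℕ i))
        ≤⟨ +-mono-≤ (∑-layers≤n ℓ (ℓ s)) (≤-trans (m≤n+m (∑[ i < ℓ s ] layer ℓ (suc (toℕ i))) (layer ℓ 0)) (∑-layers≤n ℓ (suc (ℓ s)))) ⟩
      n + n
        ≡⟨ cong (n +_) (+-identityʳ n) ⟨
      2 * n
        ∎

support : Flow n → Graph n
support D i j = D i j ∨ D j i

adj-below : (H : Graph n) {i j : Fin n} → (toℕ i <ᵇ toℕ j) ≡ true → adj H i j ≡ true → H i j ≡ true
adj-below H {i} {j} i<j adjacent rewrite i<j | <ᵇ-false {toℕ j} {toℕ i} (<⇒≯ (<ᵇ-sound i<j)) =
  trans (sym (∨-identityʳ (H i j))) adjacent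

support-⪯ : (G : Graph n) (D : Flow n) → SupportIn (adj G) D → support D ⪯ G
support-⪯ G D supported i j i<j Dij∨Dji with D i j in ij
... | true  = adj-below G i<j (supported i j ij)
... | false = adj-below G i<j (trans (adj-sym G i j) (supported j i Dij∨Dji))

adj-support : (D : Flow n) {u v : Fin n} → ¬ u ≡ v → D u v ≡ true → adj (support D) u v ≡ true
adj-support D {u} {v} u≢v uv with <-cmp (toℕ u) (toℕ v)
... | tri< u<v _ _ rewrite <ᵇ-true u<v | uv = refl
... | tri≈ _ u≡v _ = contradiction (toℕ-injective u≡v) u≢v
... | tri> _ _ v<u rewrite <ᵇ-false {toℕ u} {toℕ v} (<⇒≯ v<u) | <ᵇ-true v<u | uv = ∨-zeroʳ (D v u)

crossing≤cutValue-support : (D : Flow n) (S : VSet n) → crossing D S ≤ cutValue (support D) S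
crossing≤cutValue-support D S = begin
  crossing D S                    ≤⟨ ∑∑-mono-≤ (λ u v → 𝟙-∧-mono (D u v) (leaves S u v) (λ Duv u→v → adj-support D (leaves-irrefl u→v) Duv)) ⟩
  crossing (adj (support D)) S    ≡⟨ cutValue≡crossing (support D) S ⟨
  cutValue (support D) S          ∎
  where
  open ≤-Reasoning
  leaves-irrefl : ∀ {u v} → leaves S u v ≡ true → ¬ u ≡ v
  leaves-irrefl {u} u→v refl with S u
  leaves-irrefl () refl | true
  leaves-irrefl () refl | false
  𝟙-∧-mono : ∀ d L {a} → (d ≡ true → L ≡ true → a ≡ true) → 𝟙 (d ∧ L) ≤ 𝟙 (a ∧ L)
  𝟙-∧-mono true true  d⇒a rewrite d⇒a refl refl = ≤-refl
  𝟙-∧-mono true false _   = z≤n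
  𝟙-∧-mono false _    _   = z≤n

-- The augmenting-path search

record State (n : ℕ) : Set where
  field
    flow  : Flow n
    value : ℕ
    label : Fin n → ℕ
    head  : Fin n
    stack : List (Fin n)

open State

module AugmentingPaths (s t : Fin n) (B : ℕ) where

  initial : State n
  initial = record { flow = λ _ _ → false ; value = 0 ; label = λ _ → 0 ; head = s ; stack = [] }

  advance : State n → Fin n → State n
  advance σ y = if y == t
    then record σ { flow = push (flow σ) (head σ) y ; value = suc (value σ) ; head = s ; stack = [] }
    else record σ { flow = push (flow σ) (head σ) y ; head = y ; stack = head σ ∷ stack σ }

  retreatTo : State n → List (Fin n) → State n
  retreatTo σ []      = record σ { label = raise (label σ) (head σ) }
  retreatTo σ (u ∷ p) = record σ { flow = push (flow σ) (head σ) u ; label = raise (label σ) (head σ)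
                                 ; head = u ; stack = p }

  -- Admissible arcs that cancel flow can be read off the flow; the others are located with cut queries.
  reverseAdmissible : State n → Fin n → Bool
  reverseAdmissible σ y = flow σ y (head σ) ∧ (suc (label σ y) ≡ᵇ label σ (head σ))

  forwardCandidates : State n → VSet n
  forwardCandidates σ y = (suc (label σ y) ≡ᵇ label σ (head σ)) ∧ not (flow σ (head σ) y)

  afterSearch : State n → Maybe (Fin n) → State n
  afterSearch σ (just y) = advance σ y
  afterSearch σ nothing  = retreatTo σ (stack σ)

  step : State n → CutQueryAlg n (State n)
  step σ with firstWhere (reverseAdmissible σ)
  ... | just y  = ret (advance σ y)
  ... | nothing = findNeighbourIn (head σ) (forwardCandidates σ) >>= (ret ∘ afterSearch σ)

  loop : ℕ → State n → CutQueryAlg n (Graph n)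
  loop zero    σ = ret (support (flow σ))
  loop (suc N) σ = if B ≤ᵇ label σ s then ret (support (flow σ)) else (step σ >>= loop N)

  step-queries : (G : Graph n) (σ : State n) → queries (step σ) G ≤ 3 + 3 * logn n
  step-queries G σ with firstWhere (reverseAdmissible σ)
  ... | just y  = z≤n
  ... | nothing = begin
    queries (findNeighbourIn (head σ) X >>= (ret ∘ afterSearch σ)) G
      ≡⟨ queries->>= (findNeighbourIn (head σ) X) (ret ∘ afterSearch σ) G ⟩
    queries (findNeighbourIn (head σ) X) G + 0
      ≡⟨ +-identityʳ _ ⟩
    queries (findNeighbourIn (head σ) X) G
      ≤⟨ findNeighbourIn-queries G (head σ) X ⟩
    3 + 3 * logn n
      ∎
    where
    open ≤-Reasoning
    X : VSet n
    X = forwardCandidates σ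

  loop-queries : (G : Graph n) (N : ℕ) (σ : State n) → queries (loop N σ) G ≤ N * (3 + 3 * logn n)
  loop-queries G zero    σ = z≤n
  loop-queries G (suc N) σ with B ≤ᵇ label σ s
  ... | true  = z≤n
  ... | false = begin
    queries (step σ >>= loop N) G
      ≡⟨ queries->>= (step σ) (loop N) G ⟩
    queries (step σ) G + queries (loop N (run (step σ) G)) G
      ≤⟨ +-mono-≤ (step-queries G σ) (loop-queries G N (run (step σ) G)) ⟩
    3 + 3 * logn n + N * (3 + 3 * logn n)
      ∎
    where open ≤-Reasoning

-- Invariant and potential

private
  ∸-suc : ∀ {m k} → k < m → m ∸ k ≡ suc (m ∸ suc k)
  ∸-suc {suc m} {zero}  _         = refl
  ∸-suc {suc m} {suc k} (s≤s k<m) = ∸-suc k<m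

  ∸-pop : ∀ m k → m ∸ k ≤ suc (m ∸ suc k)
  ∸-pop zero    zero    = z≤n
  ∸-pop zero    (suc k) = z≤n
  ∸-pop (suc m) zero    = ≤-refl
  ∸-pop (suc m) (suc k) = ∸-pop m k

  augment-drop : ∀ S B R K → suc (3 * S + (B + 2) * R + B) ≤ 3 * S + (B + 2) * suc R + K
  augment-drop S B R K = ≤-trans (m≤m+n _ (1 + K)) (≤-reflexive (expand S B R K))
    where
    expand : ∀ S B R K → suc (3 * S + (B + 2) * R + B) + (1 + K) ≡ 3 * S + (B + 2) * suc R + K
    expand = solve-∀

  retreat-drop : ∀ S X K K′ → K′ ≤ suc K → suc (3 * S + X + K′) ≤ 3 * suc S + X + K
  retreat-drop S X K K′ K′≤1+K =
    ≤-trans (s≤s (+-monoʳ-≤ (3 * S + X) K′≤1+K)) (≤-trans (m≤m+n _ 1) (≤-reflexive (expand S X K)))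
    where
    expand : ∀ S X K → suc (3 * S + X + suc K) + 1 ≡ 3 * suc S + X + K
    expand = solve-∀

module Correctness (G : Graph n) (s t : Fin n) (s≢t : ¬ s ≡ t) (B : ℕ) where
  open AugmentingPaths s t B

  A : Fin n → Fin n → Bool
  A = adj G

  record Invariant (σ : State n) : Set where
    field
      supported : SupportIn A (flow σ)
      conserves : Conserves s t (flow σ) (value σ) (head σ)
      valid     : ValidLabels A (label σ) (flow σ)
      bounded   : ∀ v → label σ v ≤ B
      sink      : label σ t ≡ 0
      head≢t    : ¬ head σ ≡ t
      path      : BackPath A s (flow σ) (label σ) (head σ) (stack σ)
      settled   : head σ ≡ s ⊎ label σ s < B
      value≤n   : value σ ≤ n
  open Invariant

  slack : (Fin n → ℕ) → ℕ
  slack ℓ = ∑[ v < n ] (B ∸ ℓ v)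

  -- Raising a label, augmenting, and advancing lower it by at least 3, 2 and 1 respectively.
  potential : State n → ℕ
  potential σ = 3 * slack (label σ) + (B + 2) * (n ∸ value σ) + (B ∸ length (stack σ))

  Progress : State n → State n → Set
  Progress σ σ′ = Invariant σ′ × potential σ′ < potential σ

  Admissible : State n → Fin n → Set
  Admissible σ y = 0 < residual A (flow σ) (head σ) y × suc (label σ y) ≡ label σ (head σ)

  module _ (σ : State n) (I : Invariant σ) (active : label σ s < B) where
    private
      D : Flow n
      D = flow σ
      φ : ℕ
      φ = value σ
      ℓ : Fin n → ℕ
      ℓ = label σ
      x : Fin n
      x = head σ
      p : List (Fin n)
      p = stack σ

    head≤source : ℓ x ≤ ℓ s
    head≤source = ≤-trans (m≤n+m (ℓ x) (length p)) (≤-reflexive (sym (backPath-length A s D ℓ x p (path I))))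

    module _ (y : Fin n) (admissible : Admissible σ y) where
      private
        r : 0 < residual A D x y
        r = proj₁ admissible
        ℓy+1≡ℓx : suc (ℓ y) ≡ ℓ x
        ℓy+1≡ℓx = proj₂ admissible
        D′ : Flow n
        D′ = push D x y
        ℓy≤1+ℓx : ℓ y ≤ suc (ℓ x)
        ℓy≤1+ℓx = ≤-trans (≤-trans (n≤1+n (ℓ y)) (≤-reflexive ℓy+1≡ℓx)) (n≤1+n (ℓ x))

      augment-progress : y ≡ t → Progress σ (record σ { flow = D′ ; value = suc φ ; head = s ; stack = [] })
      augment-progress refl = record
        { supported = push-support A D x t (supported I) r
        ; conserves = conserves-complete s t D′ φ (push-conserves A s t D φ x t r (conserves I))
        ; valid     = push-valid A ℓ D x t (valid I) r ℓy≤1+ℓx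
        ; bounded   = bounded I
        ; sink      = sink I
        ; head≢t    = s≢t
        ; path      = refl
        ; settled   = inj₁ refl
        ; value≤n   = φ<n
        } , (begin-strict
          3 * slack ℓ + (B + 2) * (n ∸ suc φ) + (B ∸ 0)       <⟨ augment-drop (slack ℓ) B (n ∸ suc φ) (B ∸ length p) ⟩
          3 * slack ℓ + (B + 2) * suc (n ∸ suc φ) + (B ∸ length p) ≡⟨ cong (λ R → 3 * slack ℓ + (B + 2) * R + (B ∸ length p)) (∸-suc φ<n) ⟨
          potential σ                                           ∎)
        where
        open ≤-Reasoning
        φ<n : suc φ ≤ n
        φ<n = ≤-trans (value≤outflow s t s≢t D′ (suc φ) (conserves-complete s t D′ φ (push-conserves A s t D φ x t r (conserves I))))
                      (∑-𝟙≤ (D′ s))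

      extend-progress : ¬ y ≡ t → Progress σ (record σ { flow = D′ ; head = y ; stack = x ∷ p })
      extend-progress y≢t = record
        { supported = push-support A D x y (supported I) r
        ; conserves = push-conserves A s t D φ x y r (conserves I)
        ; valid     = push-valid A ℓ D x y (valid I) r ℓy≤1+ℓx
        ; bounded   = bounded I
        ; sink      = sink I
        ; head≢t    = y≢t
        ; path      = sym ℓy+1≡ℓx , push-reverse A D x y (supported I) , backPath-flow A s D D′ ℓ x p (ℓ x) ≤-refl untouched (path I)
        ; settled   = inj₂ active
        ; value≤n   = value≤n I
        } , +-monoʳ-< (3 * slack ℓ + (B + 2) * (n ∸ φ)) (∸-monoʳ-< (n<1+n (length p)) 1+|p|≤B)
        where
        above-y : ∀ {v} → ℓ x ≤ ℓ v → ¬ v ≡ y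
        above-y ℓx≤ℓv refl = <-irrefl refl (≤-trans (≤-reflexive ℓy+1≡ℓx) ℓx≤ℓv)
        untouched : ∀ i j → ℓ x ≤ ℓ i → ℓ x ≤ ℓ j → D′ i j ≡ D i j
        untouched i j ℓx≤ℓi ℓx≤ℓj = push-avoiding D x y y i j (inj₂ refl) (above-y ℓx≤ℓi) (above-y ℓx≤ℓj)
        1+|p|≤B : suc (length p) ≤ B
        1+|p|≤B = ≤-trans (≤-trans (≤-reflexive (+-comm 1 (length p))) (+-monoʳ-≤ (length p) (≤-trans (s≤s z≤n) (≤-reflexive ℓy+1≡ℓx))))
                          (≤-trans (≤-reflexive (sym (backPath-length A s D ℓ x p (path I)))) (<⇒≤ active))

      advance-progress : Progress σ (advance σ y)
      advance-progress with y ≟ᶠ t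
      ... | yes y≡t = augment-progress y≡t
      ... | no  y≢t = extend-progress y≢t

    module _ (no-admissible : ∀ y → 0 < residual A D x y → ¬ suc (ℓ y) ≡ ℓ x) where
      private
        ℓ′ : Fin n → ℕ
        ℓ′ = raise ℓ x
        1+ℓx≤B : suc (ℓ x) ≤ B
        1+ℓx≤B = ≤-trans (s≤s head≤source) active
        x≢t : ¬ x ≡ t
        x≢t = head≢t I

      raised-bounded : ∀ v → ℓ′ v ≤ B
      raised-bounded v with v ≟ᶠ x
      ... | yes refl = 1+ℓx≤B
      ... | no  _    = bounded I v

      raised-sink : ℓ′ t ≡ 0
      raised-sink = trans (raise-elsewhere ℓ (x≢t ∘ sym)) (sink I)

      raised-slack : suc (slack ℓ′) ≡ slack ℓ
      raised-slack = +-cancelʳ-≡ (B ∸ ℓ′ x) _ _ (begin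
        suc (slack ℓ′) + (B ∸ ℓ′ x)    ≡⟨ +-suc (slack ℓ′) (B ∸ ℓ′ x) ⟨
        slack ℓ′ + suc (B ∸ ℓ′ x)      ≡⟨ cong (λ m → slack ℓ′ + suc (B ∸ m)) (raise-here ℓ x) ⟩
        slack ℓ′ + suc (B ∸ suc (ℓ x)) ≡⟨ cong (slack ℓ′ +_) (∸-suc 1+ℓx≤B) ⟨
        slack ℓ′ + (B ∸ ℓ x)           ≡⟨ ∑-update x (λ v → B ∸ ℓ v) (λ v → B ∸ ℓ′ v) (λ v v≢x → cong (B ∸_) (raise-elsewhere ℓ v≢x)) ⟩
        slack ℓ + (B ∸ ℓ′ x)           ∎)
        where open ≡-Reasoning

      restart-progress : p ≡ [] → Progress σ (retreatTo σ [])
      restart-progress refl = record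
        { supported = supported I
        ; conserves = conserves I
        ; valid     = raise-valid A ℓ D x (valid I) no-admissible
        ; bounded   = raised-bounded
        ; sink      = raised-sink
        ; head≢t    = x≢t
        ; path      = path I
        ; settled   = inj₁ (path I)
        ; value≤n   = value≤n I
        } , (begin-strict
          3 * slack ℓ′ + (B + 2) * (n ∸ φ) + (B ∸ 0)       <⟨ retreat-drop (slack ℓ′) _ B B (n≤1+n B) ⟩
          3 * suc (slack ℓ′) + (B + 2) * (n ∸ φ) + (B ∸ 0) ≡⟨ cong (λ S → 3 * S + (B + 2) * (n ∸ φ) + B) raised-slack ⟩
          potential σ                                      ∎)
        where open ≤-Reasoning

      backtrack-progress : ∀ u q → p ≡ u ∷ q → Progress σ (retreatTo σ (u ∷ q))
      backtrack-progress u q refl = record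
        { supported = push-support A D x u (supported I) r
        ; conserves = push-conserves A s t D φ x u r (conserves I)
        ; valid     = push-valid A ℓ′ D x u (raise-valid A ℓ D x (valid I) no-admissible) r ℓ′u≤1+ℓ′x
        ; bounded   = raised-bounded
        ; sink      = raised-sink
        ; head≢t    = λ { refl → 0≢1+n (trans (sym (sink I)) ℓu≡1+ℓx) }
        ; path      = backPath-labels A s D′ ℓ ℓ′ u q (ℓ u) ≤-refl (λ v ℓu≤ℓv → raise-elsewhere ℓ (above-x ℓu≤ℓv))
                        (backPath-flow A s D D′ ℓ u q (ℓ u) ≤-refl untouched rest)
        ; settled   = inj₂ (subst (_< B) (sym (raise-elsewhere ℓ (above-x ℓu≤ℓs))) active)
        ; value≤n   = value≤n I
        } , (begin-strict
          3 * slack ℓ′ + (B + 2) * (n ∸ φ) + (B ∸ length q)       <⟨ retreat-drop (slack ℓ′) _ (B ∸ suc (length q)) (B ∸ length q) (∸-pop B (length q)) ⟩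
          3 * suc (slack ℓ′) + (B + 2) * (n ∸ φ) + (B ∸ length p) ≡⟨ cong (λ S → 3 * S + (B + 2) * (n ∸ φ) + (B ∸ length p)) raised-slack ⟩
          potential σ                                             ∎)
        where
        open ≤-Reasoning
        D′ : Flow n
        D′ = push D x u
        ℓu≡1+ℓx : ℓ u ≡ suc (ℓ x)
        ℓu≡1+ℓx = proj₁ (path I)
        r : 0 < residual A D x u
        r = proj₁ (proj₂ (path I))
        rest : BackPath A s D ℓ u q
        rest = proj₂ (proj₂ (path I))
        above-x : ∀ {v} → ℓ u ≤ ℓ v → ¬ v ≡ x
        above-x ℓu≤ℓv refl = <-irrefl refl (≤-trans (≤-reflexive (sym ℓu≡1+ℓx)) ℓu≤ℓv)
        ℓu≤ℓs : ℓ u ≤ ℓ s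
        ℓu≤ℓs = ≤-trans (m≤n+m (ℓ u) (length q)) (≤-reflexive (sym (backPath-length A s D ℓ u q rest)))
        ℓ′u≤1+ℓ′x : ℓ′ u ≤ suc (ℓ′ x)
        ℓ′u≤1+ℓ′x = ≤-trans (≤-reflexive (trans (raise-elsewhere ℓ (above-x ≤-refl)) (trans ℓu≡1+ℓx (sym (raise-here ℓ x))))) (n≤1+n _)
        untouched : ∀ i j → ℓ u ≤ ℓ i → ℓ u ≤ ℓ j → D′ i j ≡ D i j
        untouched i j ℓu≤ℓi ℓu≤ℓj = push-avoiding D x u x i j (inj₁ refl) (above-x ℓu≤ℓi) (above-x ℓu≤ℓj)

      retreat-progress : Progress σ (retreatTo σ p)
      retreat-progress = retreat-to p refl
        where
        retreat-to : ∀ q → p ≡ q → Progress σ (retreatTo σ q)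
        retreat-to []      = restart-progress
        retreat-to (u ∷ q) = backtrack-progress u q

    x∉candidates : forwardCandidates σ x ≡ false
    x∉candidates = cong (_∧ not (D x x)) (≡ᵇ-false (1+n≢n {ℓ x}))

    step-progress : Progress σ (run (step σ) G)
    step-progress with firstWhere (reverseAdmissible σ) | firstWhere-found (reverseAdmissible σ)
    ... | just y  | y-reverse =
      advance-progress y (residual-of-reverse A D x y (∧-true-l y-reverse) , ≡ᵇ-sound (∧-true-r {D y x} y-reverse))
    ... | nothing | no-reverse =
      subst (Progress σ) (sym (run->>= (findNeighbourIn x X) (ret ∘ afterSearch σ) G))
            (after-search (run (findNeighbourIn x X) G) (findNeighbourIn-correct G x X x∉candidates))
      where
      X : VSet n
      X = forwardCandidates σ
      after-search : ∀ r → NeighbourSpec A x X r → Progress σ (afterSearch σ r)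
      after-search (just y) (y∈X , Axy) = advance-progress y (residual-of-unused A D x y unused , ≡ᵇ-sound (∧-true-l y∈X))
        where
        unused : (A x y ∧ not (D x y)) ≡ true
        unused = subst (λ b → (b ∧ not (D x y)) ≡ true) (sym Axy) (∧-true-r {suc (ℓ y) ≡ᵇ ℓ x} y∈X)
      after-search nothing no-neighbour = retreat-progress no-admissible
        where
        no-admissible : ∀ y → 0 < residual A D x y → ¬ suc (ℓ y) ≡ ℓ x
        no-admissible y r ℓy+1≡ℓx with D y x in yx
        ... | true  = contradiction (trans (sym (cong₂ _∧_ yx (≡ᵇ-true ℓy+1≡ℓx))) (no-reverse y)) λ ()
        ... | false = contradiction (trans (sym (∧-true-l unused)) (no-neighbour y y∈X)) λ ()
          where
          unused : (A x y ∧ not (D x y)) ≡ true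
          unused = 𝟙-pos r
          y∈X : X y ≡ true
          y∈X = cong₂ _∧_ (≡ᵇ-true ℓy+1≡ℓx) (∧-true-r {A x y} unused)

  initial-invariant : Invariant initial
  initial-invariant = record
    { supported = λ _ _ ()
    ; conserves = λ w → cong (λ m → ∑[ z < n ] 0 + m + 𝟙 (w == s))
                             (trans (*-zeroʳ (𝟙 (w == t))) (sym (*-zeroʳ (𝟙 (w == s)))))
    ; valid     = λ _ _ _ → z≤n
    ; bounded   = λ _ → z≤n
    ; sink      = refl
    ; head≢t    = s≢t
    ; path      = refl
    ; settled   = inj₁ refl
    ; value≤n   = z≤n
    }

  initial-potential : potential initial ≡ 3 * (n * B) + (B + 2) * n + B
  initial-potential = cong (λ S → 3 * S + (B + 2) * n + B) (∑-const n B)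

  module Outcome (f Δ : ℕ) (promise : νAtLeast G s t f) (B-large : 2 * (n * n) < B * B * suc Δ) where

    Sound : Graph n → Set
    Sound H = H ⪯ G × νAtLeast H s t (f ∸ Δ)

    finished-sound : (σ : State n) → Invariant σ → B ≤ label σ s → Sound (support (flow σ))
    finished-sound σ I B≤ℓs = support-⪯ G D (supported I) , certified
      where
      D : Flow n
      D = flow σ
      φ : ℕ
      φ = value σ
      ℓ : Fin n → ℕ
      ℓ = label σ
      complete : Conserves s t D φ s
      complete with settled I
      ... | inj₁ head≡s = subst (Conserves s t D φ) head≡s (conserves I)
      ... | inj₂ ℓs<B  = contradiction B≤ℓs (<⇒≱ ℓs<B)
      f≤cut : ∀ S → S s ≡ true → S t ≡ false → f ≤ crossing A S
      f≤cut S s∈S t∉S = subst (f ≤_) (cutValue≡crossing G S) (promise S s∈S t∉S)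
      enough : f ∸ Δ ≤ φ
      enough with f ∸ Δ ≤? φ
      ... | yes enough = enough
      ... | no  short  = contradiction (labels-bound A s t D φ ℓ f Δ (supported I) complete (valid I) (sink I) f≤cut φ+Δ<f)
                                       (<⇒≱ (<-≤-trans B-large (*-monoˡ-≤ (suc Δ) (*-mono-≤ B≤ℓs B≤ℓs))))
        where
        φ<f∸Δ : φ < f ∸ Δ
        φ<f∸Δ = ≰⇒> short
        Δ<f : Δ < f
        Δ<f = m∸n≢0⇒n<m {f} {Δ} (λ f∸Δ≡0 → contradiction (subst (suc φ ≤_) f∸Δ≡0 φ<f∸Δ) λ ())
        φ+Δ<f : suc (φ + Δ) ≤ f
        φ+Δ<f = ≤-trans (+-monoˡ-≤ Δ φ<f∸Δ) (≤-reflexive (m∸n+n≡m (<⇒≤ Δ<f)))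
      certified : νAtLeast (support D) s t (f ∸ Δ)
      certified S s∈S t∉S = begin
        f ∸ Δ                         ≤⟨ enough ⟩
        φ                             ≤⟨ m≤n+m φ (crossing (transpose D) S) ⟩
        crossing (transpose D) S + φ  ≡⟨ net-flow-across-cut s t D φ S s∈S t∉S complete ⟨
        crossing D S                  ≤⟨ crossing≤cutValue-support D S ⟩
        cutValue (support D) S        ∎
        where open ≤-Reasoning

    loop-sound : ∀ N σ → Invariant σ → potential σ < N → Sound (run (loop N σ) G)
    loop-sound (suc N) σ I pot<1+N with B ≤ᵇ label σ s in finished
    ... | true  = finished-sound σ I (≤ᵇ-sound finished)
    ... | false = subst Sound (sym (run->>= (step σ) (loop N) G))
                        (loop-sound N (run (step σ) G) (proj₁ progress) (≤-trans (proj₂ progress) (≤-pred pot<1+N)))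
      where
      progress : Progress σ (run (step σ) G)
      progress = step-progress σ I (≰⇒> (does-false (B ≤? label σ s) finished))

-- Choice of the label bound and the query count

leastFrom : (ℕ → Bool) → ℕ → ℕ → ℕ
leastFrom P zero    lo = lo
leastFrom P (suc k) lo = if P lo then lo else leastFrom P k (suc lo)

leastFrom-satisfies : (P : ℕ → Bool) (k lo : ℕ) → P (lo + k) ≡ true → P (leastFrom P k lo) ≡ true
leastFrom-satisfies P zero    lo sat = subst (λ b → P b ≡ true) (+-identityʳ lo) sat
leastFrom-satisfies P (suc k) lo sat with P lo in here
... | true  = here
... | false = leastFrom-satisfies P k (suc lo) (subst (λ b → P b ≡ true) (+-suc lo k) sat)

leastFrom-least : (P : ℕ → Bool) (k lo : ℕ) → (∀ c → c < lo → P c ≡ false) → ∀ c → c < leastFrom P k lo → P c ≡ false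
leastFrom-least P zero    lo below = below
leastFrom-least P (suc k) lo below with P lo in here
... | true  = below
... | false = leastFrom-least P k (suc lo) below′
  where
  below′ : ∀ c → c < suc lo → P c ≡ false
  below′ c c<1+lo with m<1+n⇒m<n∨m≡n c<1+lo
  ... | inj₁ c<lo = below c c<lo
  ... | inj₂ refl = here

heightBound : ℕ → ℕ → ℕ
heightBound n Δ = leastFrom (λ b → 2 * (n * n) <ᵇ b * b * suc Δ) (suc (2 * (n * n))) 0

heightBound-large : ∀ n Δ → 2 * (n * n) < heightBound n Δ * heightBound n Δ * suc Δ
heightBound-large n Δ = <ᵇ-sound (leastFrom-satisfies (λ b → 2 * (n * n) <ᵇ b * b * suc Δ) (suc T) 0
  (<ᵇ-true (≤-trans (m≤m*n (suc T) (suc T)) (m≤m*n (suc T * suc T) (suc Δ)))))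
  where
  T : ℕ
  T = 2 * (n * n)

heightBound-least : ∀ n Δ b → heightBound n Δ ≡ suc b → b * b * suc Δ ≤ 2 * (n * n)
heightBound-least n Δ b B≡1+b = ≮⇒≥ (does-false (2 * (n * n) <? b * b * suc Δ)
  (leastFrom-least (λ b → 2 * (n * n) <ᵇ b * b * suc Δ) (suc (2 * (n * n))) 0 (λ _ ()) b (≤-reflexive (sym B≡1+b))))

heightBound-suc : ∀ n Δ → ∃ λ b → heightBound n Δ ≡ suc b
heightBound-suc n Δ with heightBound n Δ | heightBound-large n Δ
... | suc b | _ = b , refl

heightBound² : ∀ n Δ → Δ ≤ 2 * (n * n) → heightBound n Δ * heightBound n Δ * Δ ≤ 8 * (n * n)
heightBound² n Δ Δ≤2n² with heightBound-suc n Δ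
... | b , B≡1+b rewrite B≡1+b = begin
  suc b * suc b * Δ               ≡⟨ expand b Δ ⟩
  b * b * Δ + Δ + 2 * b * Δ       ≤⟨ +-monoʳ-≤ (b * b * Δ + Δ) (*-monoˡ-≤ Δ (2b≤b²+1 b)) ⟩
  b * b * Δ + Δ + (b * b + 1) * Δ ≡⟨ collect b Δ ⟩
  2 * (b * b * Δ) + 2 * Δ         ≤⟨ +-mono-≤ (*-monoʳ-≤ 2 b²Δ≤2n²) (*-monoʳ-≤ 2 Δ≤2n²) ⟩
  2 * (2 * (n * n)) + 2 * (2 * (n * n)) ≡⟨ eight (n * n) ⟩
  8 * (n * n)                     ∎
  where
  open ≤-Reasoning
  b²Δ≤2n² : b * b * Δ ≤ 2 * (n * n)
  b²Δ≤2n² = ≤-trans (*-monoʳ-≤ (b * b) (n≤1+n Δ)) (heightBound-least n Δ b B≡1+b)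
  2b≤b²+1 : ∀ b → 2 * b ≤ b * b + 1
  2b≤b²+1 zero    = z≤n
  2b≤b²+1 (suc c) = ≤-trans (m≤m+n _ (c * c)) (≤-reflexive (square c))
    where
    square : ∀ c → 2 * suc c + c * c ≡ suc c * suc c + 1
    square = solve-∀
  expand : ∀ b Δ → suc b * suc b * Δ ≡ b * b * Δ + Δ + 2 * b * Δ
  expand = solve-∀
  collect : ∀ b Δ → b * b * Δ + Δ + (b * b + 1) * Δ ≡ 2 * (b * b * Δ) + 2 * Δ
  collect = solve-∀
  eight : ∀ m → 2 * (2 * m) + 2 * (2 * m) ≡ 8 * m
  eight = solve-∀

cutValue≤n² : (G : Graph n) (S : VSet n) → cutValue G S ≤ n * n
cutValue≤n² {n} G S = begin
  cutValue G S        ≡⟨ cutValue≡crossing G S ⟩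
  crossing (adj G) S  ≤⟨ ∑-mono-≤ (λ u → ∑-𝟙≤ (λ v → adj G u v ∧ leaves S u v)) ⟩
  ∑[ u < n ] n        ≡⟨ ∑-const n n ⟩
  n * n               ∎
  where open ≤-Reasoning

fuel : ℕ → ℕ → ℕ
fuel n B = suc (3 * (n * B) + (B + 2) * n + B)

-- The promised value f is not needed by the algorithm, only the slack Δ.
algorithm : (n : ℕ) → Fin n → Fin n → (f Δ : ℕ) → Δ ≤ f → CutQueryAlg n (Graph n)
algorithm n s t _ Δ _ = AugmentingPaths.loop s t B (fuel n B) (AugmentingPaths.initial s t B)
  where
  B : ℕ
  B = heightBound n Δ

algorithm-sound : (n : ℕ) (s t : Fin n) → ¬ s ≡ t → (f Δ : ℕ) (Δ≤f : Δ ≤ f) (G : Graph n) → νAtLeast G s t f →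
                  (run (algorithm n s t f Δ Δ≤f) G ⪯ G) × νAtLeast (run (algorithm n s t f Δ Δ≤f) G) s t (f ∸ Δ)
algorithm-sound n s t s≢t f Δ Δ≤f G promise =
  Outcome.loop-sound f Δ promise (heightBound-large n Δ) (fuel n B) (AugmentingPaths.initial s t B) initial-invariant
                     (s≤s (≤-reflexive initial-potential))
  where
  B : ℕ
  B = heightBound n Δ
  open Correctness G s t s≢t B

private
  query-arithmetic : ∀ q L n B Δ → q ≤ 8 * (n * B) * (6 * L) → B * B * Δ ≤ 8 * (n * n) →
                     q ^ 2 * Δ ≤ 18432 * n ^ 4 * L ^ 2
  query-arithmetic q L n B Δ q≤ B²Δ≤ = begin
    q * (q * 1) * Δ                                    ≤⟨ *-monoˡ-≤ Δ (*-mono-≤ q≤ (*-monoˡ-≤ 1 q≤)) ⟩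
    Q * (Q * 1) * Δ                                    ≡⟨ regroup L n B Δ ⟩
    2304 * (L * L) * (n * n) * (B * B * Δ)             ≤⟨ *-monoʳ-≤ (2304 * (L * L) * (n * n)) B²Δ≤ ⟩
    2304 * (L * L) * (n * n) * (8 * (n * n))           ≡⟨ collect L n ⟩
    18432 * (n * (n * (n * (n * 1)))) * (L * (L * 1))  ∎
    where
    open ≤-Reasoning
    Q : ℕ
    Q = 8 * (n * B) * (6 * L)
    regroup : ∀ L n B Δ → 8 * (n * B) * (6 * L) * (8 * (n * B) * (6 * L) * 1) * Δ
                          ≡ 2304 * (L * L) * (n * n) * (B * B * Δ)
    regroup = solve-∀
    collect : ∀ L n → 2304 * (L * L) * (n * n) * (8 * (n * n)) ≡ 18432 * (n * (n * (n * (n * 1)))) * (L * (L * 1))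
    collect = solve-∀

  fuel≤8nB : ∀ n′ b → fuel (suc n′) (suc b) ≤ 8 * (suc n′ * suc b)
  fuel≤8nB n′ b = ≤-trans (m≤m+n _ (4 * n′ * b + 2 * n′ + 3 * b)) (≤-reflexive (expand n′ b))
    where
    expand : ∀ n′ b → suc (3 * (suc n′ * suc b) + (suc b + 2) * suc n′ + suc b) + (4 * n′ * b + 2 * n′ + 3 * b)
                      ≡ 8 * (suc n′ * suc b)
    expand = solve-∀

  3+3L≤6L : ∀ L → 3 + 3 * suc L ≤ 6 * suc L
  3+3L≤6L L = ≤-trans (m≤m+n _ (3 * L)) (≤-reflexive (expand L))
    where
    expand : ∀ L → 3 + 3 * suc L + 3 * L ≡ 6 * suc L
    expand = solve-∀

algorithm-queries : (n : ℕ) (s t : Fin n) → ¬ s ≡ t → (f Δ : ℕ) (Δ≤f : Δ ≤ f) (G : Graph n) → νAtLeast G s t f →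
                    queries (algorithm n s t f Δ Δ≤f) G ^ 2 * Δ ≤ 18432 * n ^ 4 * logn n ^ 2
algorithm-queries n@(suc n′) s t s≢t f Δ Δ≤f G promise with heightBound-suc n Δ
... | b , B≡1+b = query-arithmetic _ (logn n) n B Δ q-bound (heightBound² n Δ Δ≤2n²)
  where
  B : ℕ
  B = heightBound n Δ
  Δ≤2n² : Δ ≤ 2 * (n * n)
  Δ≤2n² = ≤-trans Δ≤f (≤-trans (promise ⁅ s ⁆ (==-refl s) (==-≢ (s≢t ∘ sym)))
                                (≤-trans (cutValue≤n² G ⁅ s ⁆) (m≤m+n (n * n) (n * n + 0))))
  q-bound : queries (algorithm n s t f Δ Δ≤f) G ≤ 8 * (n * B) * (6 * logn n)
  q-bound = ≤-trans (AugmentingPaths.loop-queries s t B G (fuel n B) (AugmentingPaths.initial s t B))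
                    (*-mono-≤ (subst (λ B → fuel n B ≤ 8 * (n * B)) (sym B≡1+b) (fuel≤8nB n′ b)) (3+3L≤6L ⌊log₂ n ⌋))

mainTheorem17 : Σ ℕ λ c → Σ ℕ λ k →
  Σ ((n : ℕ) → Fin n → Fin n → (f Δ : ℕ) → Δ ≤ f → CutQueryAlg n (Graph n)) λ A →
    (n : ℕ) (s t : Fin n) → ¬ (s ≡ t) → (f Δ : ℕ) (Δ≤f : Δ ≤ f) (G : Graph n) →
    νAtLeast G s t f →
      ((run (A n s t f Δ Δ≤f) G ⪯ G)
       × νAtLeast (run (A n s t f Δ Δ≤f) G) s t (f ∸ Δ)
       × (queries (A n s t f Δ Δ≤f) G ^ 2 * Δ ≤ c * n ^ 4 * logn n ^ k))
mainTheorem17 = 18432 , 2 , algorithm , λ n s t s≢t f Δ Δ≤f G promise →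
  let subgraph , certified = algorithm-sound n s t s≢t f Δ Δ≤f G promise
  in  subgraph , certified , algorithm-queries n s t s≢t f Δ Δ≤f G promise
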